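{- Let $(P,\le)$ be a finite partially ordered set. For each near-chain $\Gamma=\{I_1,\dots,I_m\}$ of irreducible upper sets of $P$ let $\sigma_\Gamma$ be the set of nonnegative rational linear combinations of $\chi_{I_1},\dots,\chi_{I_m}$. Then the collection of cones $\sigma_\Gamma$, $\Gamma$ ranging over all near-chains of irreducible upper sets, is a unimodular triangulation (with respect to the lattice $\mathbb{Z}^P$) of the cone $\mathrm{C}(P)$.
   Context: An upper set is an upward-closed subset of $P$; an irreducible upper set is a nonempty upper set that is not the union of two disjoint nonempty upper sets; $\chi_I$ is its indicator function. A near-chain is a set of irreducible upper sets any two of which are either nested or disjoint. $\mathrm{C}(P)\subseteq\mathbb{Q}^P$ is the cone of nonnegative monotone functions $P\to\mathbb{Q}$ (monotone: $a\le b\Rightarrow f(a)\le f(b)$). -}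

module Defs where

open import Level using (0ℓ)
open import Data.Nat using (ℕ; zero; suc)
open import Data.Fin using (Fin; zero; suc)
open import Data.Bool using (true; false)
open import Data.Vec using (lookup)
open import Data.List using (List; []; _∷_; length; map; _++_)
import Data.List as L
open import Data.Product using (Σ; ∃; ∃-syntax; _×_; _,_)
open import Data.Sum using (_⊎_)
open import Data.Empty using (⊥)
open import Relation.Nullary using (¬_)
open import Relation.Binary using (IsPartialOrder; Decidable)
open import Relation.Binary.PropositionalEquality using (_≡_)
open import Data.Fin.Subset using (Subset; _∈_; _⊆_)
open import Data.List.Relation.Unary.All using (All)
open import Data.List.Relation.Unary.Unique.Propositional using (Unique)
import Data.List.Membership.Propositional as LM
open import Data.Rational using (ℚ; 0ℚ; 1ℚ) renaming (_+_ to _+ℚ_; _*_ to _*ℚ_; _≤_ to _≤ℚ_)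
open import Data.Integer using (ℤ) renaming (_+_ to _+ℤ_; _*_ to _*ℤ_; 0ℤ to 0ℤ'; 1ℤ to 1ℤ')

record FinPoset : Set₁ where
  field
    n     : ℕ
    _≼_   : Fin n → Fin n → Set
    isPO  : IsPartialOrder _≡_ _≼_
    _≼?_  : Decidable _≼_

∑ℚ : (m : ℕ) → (Fin m → ℚ) → ℚ
∑ℚ zero    f = 0ℚ
∑ℚ (suc m) f = f zero +ℚ ∑ℚ m (λ k → f (suc k))

∑ℤ : (m : ℕ) → (Fin m → ℤ) → ℤ
∑ℤ zero    f = 0ℤ'
∑ℤ (suc m) f = f zero +ℤ ∑ℤ m (λ k → f (suc k))

module _ (P : FinPoset) where
  open FinPoset P

  Vecℚ : Set
  Vecℚ = Fin n → ℚ

  Vecℤ : Set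
  Vecℤ = Fin n → ℤ

  IsUpperSet : Subset n → Set
  IsUpperSet U = ∀ a b → a ≼ b → a ∈ U → b ∈ U

  Nonempty : Subset n → Set
  Nonempty U = ∃[ a ] a ∈ U

  Disjoint : Subset n → Subset n → Set
  Disjoint U V = ∀ a → a ∈ U → a ∈ V → ⊥

  IsUnionOf : Subset n → Subset n → Subset n → Set
  IsUnionOf U V W = ∀ a → (a ∈ U → a ∈ V ⊎ a ∈ W) × (a ∈ V ⊎ a ∈ W → a ∈ U)

  IsIrreducible : Subset n → Set
  IsIrreducible U =
    IsUpperSet U × Nonempty U ×
    ¬ (Σ (Subset n) λ V → Σ (Subset n) λ W →
         IsUpperSet V × IsUpperSet W × Nonempty V × Nonempty W ×
         Disjoint V W × IsUnionOf U V W)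

  IsNearChain : List (Subset n) → Set
  IsNearChain Γ =
    All IsIrreducible Γ × Unique Γ ×
    (∀ {I J} → I LM.∈ Γ → J LM.∈ Γ → (I ⊆ J) ⊎ (J ⊆ I) ⊎ Disjoint I J)

  χ : Subset n → Vecℚ
  χ U a with lookup U a
  ... | true  = 1ℚ
  ... | false = 0ℚ

  χℤ : Subset n → Vecℤ
  χℤ U a with lookup U a
  ... | true  = 1ℤ'
  ... | false = 0ℤ'

  InC : Vecℚ → Set
  InC f = (∀ a → 0ℚ ≤ℚ f a) × (∀ a b → a ≼ b → f a ≤ℚ f b)

  InCone : List Vecℚ → Vecℚ → Set
  InCone gs f = Σ (Fin (length gs) → ℚ) λ c →
    (∀ k → 0ℚ ≤ℚ c k) ×
    (∀ a → f a ≡ ∑ℚ (length gs) (λ k → c k *ℚ L.lookup gs k a))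

  σ : List (Subset n) → Vecℚ → Set
  σ Γ = InCone (map χ Γ)

  _·_ : Vecℚ → Vecℚ → ℚ
  u · x = ∑ℚ n (λ a → u a *ℚ x a)

  Supports : Vecℚ → (Vecℚ → Set) → Set
  Supports u S = ∀ x → S x → 0ℚ ≤ℚ u · x

  FaceBy : Vecℚ → (Vecℚ → Set) → (Vecℚ → Set) → Set
  FaceBy u S F = Supports u S × (∀ x → (F x → S x × u · x ≡ 0ℚ) × (S x × u · x ≡ 0ℚ → F x))

  IsFaceOf : (Vecℚ → Set) → (Vecℚ → Set) → Set
  IsFaceOf F S = ∃[ u ] FaceBy u S F

  IsLatticeBasis : List Vecℤ → Set
  IsLatticeBasis B =
    (∀ (z : Vecℤ) → Σ (Fin (length B) → ℤ) λ c →
        ∀ a → z a ≡ ∑ℤ (length B) (λ k → c k *ℤ L.lookup B k a)) ×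
    (∀ (c : Fin (length B) → ℤ) →
        (∀ a → ∑ℤ (length B) (λ k → c k *ℤ L.lookup B k a) ≡ 0ℤ') →
        ∀ k → c k ≡ 0ℤ')

  IsUnimodular : List (Subset n) → Set
  IsUnimodular Γ = ∃[ ext ] IsLatticeBasis (map χℤ Γ ++ ext)

  -- The family {σ_Γ : Γ near-chain} is a unimodular triangulation of C(P):
  --  * its support is C(P),
  --  * it is closed under taking faces,
  --  * the intersection of any two of its cones is a face of each,
  --  * every cone is simplicial and unimodular (generators extend to a
  --    lattice basis of ℤ^P; in particular they are linearly independent).
  IsUnimodularTriangulationOfC : Set
  IsUnimodularTriangulationOfC =
    (∀ f → InC f → ∃[ Γ ] IsNearChain Γ × σ Γ f) ×
    (∀ Γ → IsNearChain Γ → ∀ f → σ Γ f → InC f) ×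
    (∀ Γ → IsNearChain Γ → ∀ u → Supports u (σ Γ) →
       ∃[ Δ ] IsNearChain Δ × FaceBy u (σ Γ) (σ Δ)) ×
    (∀ Γ Δ → IsNearChain Γ → IsNearChain Δ →
       IsFaceOf (λ x → σ Γ x × σ Δ x) (σ Γ) × IsFaceOf (λ x → σ Γ x × σ Δ x) (σ Δ)) ×
    (∀ Γ → IsNearChain Γ → IsUnimodular Γ)

-- Covering: for f in C(P), let I be a minimal nonempty upper subset of supp f that is closed
-- downwards inside supp f; such an I is irreducible.  Subtracting (min_I f) · χ I keeps f in C(P)
-- and shrinks its support, and every irreducible set inside the new support is nested in I or
-- disjoint from it, so induction on the support produces a near-chain.
--
-- Intersections: if I has a positive coefficient in a near-chain representation of x, then x ≥ t
-- on I and x < t directly below I, where t is the total coefficient of the members containing I.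
-- In any other near-chain representation of x, the largest member containing a fixed point of I
-- and of level ≥ t is I itself, by irreducibility.  Hence σ Γ ∩ σ Δ = σ (Γ ∩ Δ).  Every I in a
-- near-chain Γ has a private point q I, lying only in the members of Γ that contain I, and the
-- vectors e (q I) − e (q K), with K the least member strictly above I, are dual to the χ J; their
-- sum over Γ ∖ Δ cuts out σ (Γ ∩ Δ) as a face of σ Γ.
--
-- Unimodularity: going through Γ from smaller to larger sets, χ I replaces e (q I) in a lattice
-- basis of ℤ^P, since all the other current basis vectors vanish at q I.

module Submission where

open import Defs
open import Level using (0ℓ)
open import Function using (_∘_; id)
open import Data.Nat as ℕ using (ℕ; zero; suc)
import Data.Nat.Properties as ℕP
open import Data.Fin using (Fin; zero; suc)
import Data.Fin.Properties as FP
open import Data.Fin.Permutation using (_⟨$⟩ʳ_; _⟨$⟩ˡ_; inverseˡ; inverseʳ)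
open import Data.Fin.Subset using (Subset; _∈_; _∉_; _⊆_; _⊂_; ∣_∣; ⁅_⁆)
open import Data.Fin.Subset.Properties
  using (_∈?_; _⊆?_; _⊂?_; nonempty?; ⊆-antisym; p⊂q⇒∣p∣<∣q∣; anySubset?;
         x∈⁅x⁆; x∈⁅y⁆⇒x≡y)
open import Data.Fin.Subset.Induction using (⊂-wellFounded)
open import Data.Bool using (true; false; if_then_else_; _≟_)
open import Data.Vec using (lookup; tabulate)
import Data.Vec.Properties as VP
import Data.Vec.Functional as FV
open import Data.List as L using (List; []; _∷_; length; map; _++_)
open import Data.List.Relation.Unary.All as All using (All; []; _∷_)
open import Data.List.Relation.Unary.Any as Any using (here; there)
open import Data.List.Relation.Unary.AllPairs as AllPairs using (AllPairs; []; _∷_)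
open import Data.List.Relation.Unary.Unique.Propositional using (Unique)
import Data.List.Relation.Unary.Unique.Propositional.Properties as UniqueP
open import Data.List.Membership.Propositional using (find) renaming (_∈_ to _∈L_; _∉_ to _∉L_)
open import Data.List.Relation.Unary.All.Properties using (¬All⇒Any¬)
open import Data.List.Relation.Binary.Subset.Propositional using () renaming (_⊆_ to _⊆ᴸ_)
import Data.List.Membership.Propositional.Properties as MP
open import Data.List.Relation.Binary.Permutation.Propositional using (_↭_; ↭-sym; ↭-trans; ↭⇒↭ₛ)
import Data.List.Relation.Binary.Permutation.Propositional.Properties as PermP
import Data.List.Relation.Binary.Permutation.Setoid as PermSetoid
import Data.List.Relation.Binary.Permutation.Setoid.Properties as PermSetoidP
open import Data.Product using (Σ; ∃; ∃-syntax; _×_; _,_; proj₁; proj₂; swap)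
open import Data.Sum using (_⊎_; inj₁; inj₂)
open import Data.Empty using (⊥; ⊥-elim)
open import Relation.Nullary using (¬_; Dec; yes; no; does)
open import Relation.Nullary.Decidable using (_×-dec_; _→-dec_; ¬?; map′)
open import Relation.Binary using (DecTotalOrder; TotalPreorder; tri<; tri≈; tri>)
import Relation.Binary.Construct.Flip.EqAndOrd as Flip
open import Relation.Binary.PropositionalEquality as ≡
  using (_≡_; _≢_; refl; sym; trans; cong; cong₂; subst; subst₂)
open import Induction.WellFounded as WF using (WfRec)
import Relation.Binary.Construct.On as On
import Data.Rational as ℚ
open import Data.Rational using (ℚ; 0ℚ; 1ℚ; _+_; _*_; _-_; -_; _≤_; _<_)
import Data.Rational.Properties as QP
open import Data.Rational.Solver using (module +-*-Solver)
open import Data.Integer using (ℤ; 0ℤ; 1ℤ) renaming (_+_ to _+ℤ_; _*_ to _*ℤ_; _-_ to _-ℤ_)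
import Data.Integer.Properties as ZP
import Data.Integer.Solver as ℤSolver
import Algebra.Properties.CommutativeMonoid.Sum as CommutativeMonoidSum
import Data.List.Sort as Sort
open import Data.List.Relation.Unary.Sorted.TotalOrder.Properties using (Sorted⇒AllPairs)

module ℤΣ = CommutativeMonoidSum ZP.+-0-commutativeMonoid

0≤1 : 0ℚ ≤ 1ℚ
0≤1 = QP.<⇒≤ (QP.positive⁻¹ 1ℚ)

0≤* : ∀ {p q} → 0ℚ ≤ p → 0ℚ ≤ q → 0ℚ ≤ p * q
0≤* {p} {q} 0≤p 0≤q = subst (_≤ p * q) (QP.*-zeroˡ q) (QP.*-monoʳ-≤-nonNeg q {{ℚ.nonNegative 0≤q}} 0≤p)

*-monoˡ-≤-0≤ : ∀ {r p q} → 0ℚ ≤ r → p ≤ q → r * p ≤ r * q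
*-monoˡ-≤-0≤ {r} 0≤r = QP.*-monoˡ-≤-nonNeg r {{ℚ.nonNegative 0≤r}}

0≤∧≯0⇒≡0 : ∀ {p} → 0ℚ ≤ p → ¬ (0ℚ < p) → p ≡ 0ℚ
0≤∧≯0⇒≡0 0≤p p≯0 = QP.≤-antisym (QP.≮⇒≥ p≯0) 0≤p

p≤q⇒0≤q-p : ∀ {p q} → p ≤ q → 0ℚ ≤ q - p
p≤q⇒0≤q-p {p} {q} p≤q = subst (_≤ q - p) (QP.+-inverseʳ p) (QP.+-monoˡ-≤ (- p) p≤q)

0<q-p⇒p<q : ∀ {p q} → 0ℚ < q - p → p < q
0<q-p⇒p<q {p} {q} 0<q-p =
  subst₂ _<_ (QP.+-identityʳ p) (solve 2 (λ p q → p :+ (q :- p) := q) refl p q) (QP.+-monoʳ-< p 0<q-p)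
  where open +-*-Solver

≤∧≢⇒< : ∀ {p q} → p ≤ q → p ≢ q → p < q
≤∧≢⇒< {p} {q} p≤q p≢q with QP.<-cmp p q
... | tri< p<q _ _ = p<q
... | tri≈ _ p≡q _ = ⊥-elim (p≢q p≡q)
... | tri> _ _ p>q = ⊥-elim (QP.<-irrefl refl (QP.<-≤-trans p>q p≤q))

p*q≡0⇒p≡0 : ∀ {p q} → 0ℚ ≤ p → 0ℚ < q → p * q ≡ 0ℚ → p ≡ 0ℚ
p*q≡0⇒p≡0 {p} {q} 0≤p 0<q pq≡0 =
  0≤∧≯0⇒≡0 0≤p (λ 0<p → QP.<-irrefl (sym pq≡0)
    (subst (_< p * q) (QP.*-zeroˡ q) (QP.*-monoˡ-<-pos q {{ℚ.positive 0<q}} 0<p)))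

∑ℚ-cong : ∀ m {f g : Fin m → ℚ} → (∀ k → f k ≡ g k) → ∑ℚ m f ≡ ∑ℚ m g
∑ℚ-cong zero    f≗g = refl
∑ℚ-cong (suc m) f≗g = cong₂ _+_ (f≗g zero) (∑ℚ-cong m (f≗g ∘ suc))

∑ℚ-zero : ∀ m → ∑ℚ m (λ _ → 0ℚ) ≡ 0ℚ
∑ℚ-zero zero    = refl
∑ℚ-zero (suc m) = trans (QP.+-identityˡ _) (∑ℚ-zero m)

∑ℚ-distrib-+ : ∀ m (f g : Fin m → ℚ) → ∑ℚ m (λ k → f k + g k) ≡ ∑ℚ m f + ∑ℚ m g
∑ℚ-distrib-+ zero    f g = refl
∑ℚ-distrib-+ (suc m) f g =
  trans (cong (f zero + g zero +_) (∑ℚ-distrib-+ m (f ∘ suc) (g ∘ suc)))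
        (solve 4 (λ a b c d → (a :+ b) :+ (c :+ d) := (a :+ c) :+ (b :+ d)) refl
               (f zero) (g zero) (∑ℚ m (f ∘ suc)) (∑ℚ m (g ∘ suc)))
  where open +-*-Solver

*-distribˡ-∑ℚ : ∀ m r (f : Fin m → ℚ) → ∑ℚ m (λ k → r * f k) ≡ r * ∑ℚ m f
*-distribˡ-∑ℚ zero    r f = sym (QP.*-zeroʳ r)
*-distribˡ-∑ℚ (suc m) r f =
  trans (cong (r * f zero +_) (*-distribˡ-∑ℚ m r (f ∘ suc))) (sym (QP.*-distribˡ-+ r (f zero) _))

∑ℚ-single : ∀ m (f : Fin m → ℚ) q → (∀ k → k ≢ q → f k ≡ 0ℚ) → ∑ℚ m f ≡ f q
∑ℚ-single (suc m) f zero    f≡0 =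
  trans (cong (f zero +_) (trans (∑ℚ-cong m (λ k → f≡0 (suc k) (λ ()))) (∑ℚ-zero m))) (QP.+-identityʳ _)
∑ℚ-single (suc m) f (suc q) f≡0 =
  trans (cong (_+ ∑ℚ m (f ∘ suc)) (f≡0 zero (λ ())))
        (trans (QP.+-identityˡ _)
               (∑ℚ-single m (f ∘ suc) q (λ k k≢q → f≡0 (suc k) (k≢q ∘ FP.suc-injective))))

∑ℤ≡sum : ∀ m (f : Fin m → ℤ) → ∑ℤ m f ≡ ℤΣ.sum f
∑ℤ≡sum zero    f = refl
∑ℤ≡sum (suc m) f = cong (f zero +ℤ_) (∑ℤ≡sum m (f ∘ suc))

module _ {n : ℕ} where

  subset : {Q : Fin n → Set} → (∀ a → Dec (Q a)) → Subset n
  subset Q? = tabulate (λ a → does (Q? a))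

  ∈-subset⁻ : {Q : Fin n → Set} (Q? : ∀ a → Dec (Q a)) → ∀ {a} → a ∈ subset Q? → Q a
  ∈-subset⁻ Q? {a} a∈ with Q? a | trans (sym (VP.lookup∘tabulate _ a)) (VP.[]=⇒lookup a∈)
  ... | yes q | _ = q

  ∈-subset⁺ : {Q : Fin n → Set} (Q? : ∀ a → Dec (Q a)) → ∀ {a} → Q a → a ∈ subset Q?
  ∈-subset⁺ Q? {a} q = VP.lookup⇒[]= a _ (trans (VP.lookup∘tabulate _ a) (does-true (Q? a)))
    where
    does-true : (d : Dec _) → does d ≡ true
    does-true (yes _) = refl
    does-true (no ¬q) = ⊥-elim (¬q q)

  ⊆⇒≡⊎⊂ : ∀ {I J : Subset n} → I ⊆ J → I ≡ J ⊎ I ⊂ J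
  ⊆⇒≡⊎⊂ {I} {J} I⊆J with FP.any? (λ a → (a ∈? J) ×-dec ¬? (a ∈? I))
  ... | yes (a , a∈J , a∉I) = inj₂ (I⊆J , a , a∈J , a∉I)
  ... | no ∄ = inj₁ (⊆-antisym I⊆J J⊆I)
    where
    J⊆I : J ⊆ I
    J⊆I {a} a∈J with a ∈? I
    ... | yes a∈I = a∈I
    ... | no  a∉I = ⊥-elim (∄ (a , a∈J , a∉I))

  _≟ˢ_ : (I J : Subset n) → Dec (I ≡ J)
  _≟ˢ_ = VP.≡-dec _≟_

  _∈ˢ?_ : (I : Subset n) (Γ : List (Subset n)) → Dec (I ∈L Γ)
  I ∈ˢ? Γ = Any.any? (I ≟ˢ_) Γ

  ⊂⇒≱ : ∀ {I J : Subset n} → I ⊂ J → ¬ (∣ J ∣ ℕ.≤ ∣ I ∣)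
  ⊂⇒≱ I⊂J ∣J∣≤∣I∣ = ℕP.<⇒≱ (p⊂q⇒∣p∣<∣q∣ I⊂J) ∣J∣≤∣I∣

∈⇒↭∷ : ∀ {A : Set} {x : A} {xs} → x ∈L xs → ∃[ ys ] xs ↭ x ∷ ys
∈⇒↭∷ x∈ with MP.∈-∃++ x∈
... | ys , zs , refl = ys ++ zs , PermP.shift _ ys zs

module _ {A : Set} (O : TotalPreorder 0ℓ 0ℓ 0ℓ) (μ : A → TotalPreorder.Carrier O) where
  open TotalPreorder O using (_≲_; total) renaming (refl to ≲-refl; trans to ≲-trans)

  Least : (A → Set) → List A → Set
  Least Q xs = (∀ x → x ∈L xs → ¬ Q x) ⊎
               (∃[ x ] x ∈L xs × Q x × (∀ y → y ∈L xs → Q y → μ x ≲ μ y))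

  least : {Q : A → Set} → (∀ x → Dec (Q x)) → (xs : List A) → Least Q xs
  least Q? [] = inj₁ (λ x ())
  least Q? (x ∷ xs) with Q? x | least Q? xs
  ... | no ¬Qx | inj₁ none = inj₁ λ { y (here refl) → ¬Qx ; y (there y∈) → none y y∈ }
  ... | no ¬Qx | inj₂ (z , z∈ , Qz , min) =
    inj₂ (z , there z∈ , Qz , λ { y (here refl) Qy → ⊥-elim (¬Qx Qy) ; y (there y∈) → min y y∈ })
  ... | yes Qx | inj₁ none =
    inj₂ (x , here refl , Qx , λ { y (here refl) _ → ≲-refl ; y (there y∈) Qy → ⊥-elim (none y y∈ Qy) })
  ... | yes Qx | inj₂ (z , z∈ , Qz , min) with total (μ x) (μ z)
  ...   | inj₁ x≲z =
    inj₂ (x , here refl , Qx , λ { y (here refl) _ → ≲-refl ; y (there y∈) Qy → ≲-trans x≲z (min y y∈ Qy) })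
  ...   | inj₂ z≲x =
    inj₂ (z , there z∈ , Qz , λ { y (here refl) _ → z≲x ; y (there y∈) → min y y∈ })

Smallest Largest : ∀ {n} → (Subset n → Set) → List (Subset n) → Set
Smallest = Least ℕP.≤-totalPreorder ∣_∣
Largest  = Least (Flip.totalPreorder ℕP.≤-totalPreorder) ∣_∣

smallest : ∀ {n} {Q : Subset n → Set} → (∀ x → Dec (Q x)) → (xs : List (Subset n)) → Smallest Q xs
smallest = least ℕP.≤-totalPreorder ∣_∣

largest : ∀ {n} {Q : Subset n → Set} → (∀ x → Dec (Q x)) → (xs : List (Subset n)) → Largest Q xs
largest = least (Flip.totalPreorder ℕP.≤-totalPreorder) ∣_∣

module _ (P : FinPoset) where
  open FinPoset P

  upper? : (U : Subset n) → Dec (IsUpperSet P U)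
  upper? U = FP.all? λ a → FP.all? λ b → (a ≼? b) →-dec ((a ∈? U) →-dec (b ∈? U))

  irreducible-indecomposable : ∀ {U V} → IsIrreducible P U → IsUpperSet P V → V ⊆ U →
    (∀ a b → a ∈ U → a ∉ V → a ≼ b → b ∈ V → ⊥) → (∀ a → a ∉ V) ⊎ U ⊆ V
  irreducible-indecomposable {U} {V} (upper-U , _ , no-split) upper-V V⊆U U∖V-upper
    with nonempty? V | FP.any? (λ a → (a ∈? U) ×-dec ¬? (a ∈? V))
  ... | no ∄v | _ = inj₁ (λ a a∈V → ∄v (a , a∈V))
  ... | yes _ | no ∄w = inj₂ U⊆V
    where
    U⊆V : U ⊆ V
    U⊆V {a} a∈U with a ∈? V
    ... | yes a∈V = a∈V
    ... | no  a∉V = ⊥-elim (∄w (a , a∈U , a∉V))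
  ... | yes ∃v | yes (w , w∈U , w∉V) =
    ⊥-elim (no-split (V , W , upper-V , upper-W , ∃v , (w , ∈-subset⁺ U∖V? (w∈U , w∉V)) , disjoint , union))
    where
    U∖V? = λ a → (a ∈? U) ×-dec ¬? (a ∈? V)
    W = subset U∖V?
    upper-W : IsUpperSet P W
    upper-W a b a≼b a∈W with ∈-subset⁻ U∖V? a∈W
    ... | a∈U , a∉V = ∈-subset⁺ U∖V? (upper-U a b a≼b a∈U , U∖V-upper a b a∈U a∉V a≼b)
    disjoint : Disjoint P V W
    disjoint a a∈V a∈W = proj₂ (∈-subset⁻ U∖V? a∈W) a∈V
    union : IsUnionOf P U V W
    union a = split , join
      where
      split : a ∈ U → a ∈ V ⊎ a ∈ W
      split a∈U with a ∈? V
      ... | yes a∈V = inj₁ a∈V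
      ... | no  a∉V = inj₂ (∈-subset⁺ U∖V? (a∈U , a∉V))
      join : a ∈ V ⊎ a ∈ W → a ∈ U
      join (inj₁ a∈V) = V⊆U a∈V
      join (inj₂ a∈W) = proj₁ (∈-subset⁻ U∖V? a∈W)

  χ-∈ : ∀ {U a} → a ∈ U → χ P U a ≡ 1ℚ
  χ-∈ {U} {a} a∈U with lookup U a | VP.[]=⇒lookup a∈U
  ... | true | _ = refl

  χ-∉ : ∀ {U a} → a ∉ U → χ P U a ≡ 0ℚ
  χ-∉ {U} {a} a∉U with lookup U a in eq
  ... | true  = ⊥-elim (a∉U (VP.lookup⇒[]= a U eq))
  ... | false = refl

  χ-nonneg : ∀ U a → 0ℚ ≤ χ P U a
  χ-nonneg U a with a ∈? U
  ... | yes a∈U = subst (0ℚ ≤_) (sym (χ-∈ a∈U)) 0≤1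
  ... | no  a∉U = QP.≤-reflexive (sym (χ-∉ a∉U))

  χ-mono : ∀ {U} → IsUpperSet P U → ∀ a b → a ≼ b → χ P U a ≤ χ P U b
  χ-mono {U} upper a b a≼b with a ∈? U
  ... | yes a∈U = QP.≤-reflexive (trans (χ-∈ a∈U) (sym (χ-∈ (upper a b a≼b a∈U))))
  ... | no  a∉U = subst (_≤ χ P U b) (sym (χ-∉ a∉U)) (χ-nonneg U b)

  χℤ-∈ : ∀ {U a} → a ∈ U → χℤ P U a ≡ 1ℤ
  χℤ-∈ {U} {a} a∈U with lookup U a | VP.[]=⇒lookup a∈U
  ... | true | _ = refl

  χℤ-∉ : ∀ {U a} → a ∉ U → χℤ P U a ≡ 0ℤ
  χℤ-∉ {U} {a} a∉U with lookup U a in eq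
  ... | true  = ⊥-elim (a∉U (VP.lookup⇒[]= a U eq))
  ... | false = refl

  [_⊆_] : Subset n → Subset n → ℚ
  [ K ⊆ J ] = if does (K ⊆? J) then 1ℚ else 0ℚ

  [⊆]-nonneg : ∀ K J → 0ℚ ≤ [ K ⊆ J ]
  [⊆]-nonneg K J with K ⊆? J
  ... | yes _ = 0≤1
  ... | no  _ = QP.≤-refl

  [⊆]-yes : ∀ {K J} → K ⊆ J → [ K ⊆ J ] ≡ 1ℚ
  [⊆]-yes {K} {J} K⊆J with K ⊆? J
  ... | yes _    = refl
  ... | no  K⊈J = ⊥-elim (K⊈J K⊆J)

  [⊆]-no : ∀ {K J} → ¬ K ⊆ J → [ K ⊆ J ] ≡ 0ℚ
  [⊆]-no {K} {J} K⊈J with K ⊆? J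
  ... | yes K⊆J = ⊥-elim (K⊈J K⊆J)
  ... | no  _   = refl

  [⊆]≤χ : ∀ {K a} → a ∈ K → ∀ J → [ K ⊆ J ] ≤ χ P J a
  [⊆]≤χ {K} a∈K J with K ⊆? J
  ... | yes K⊆J = QP.≤-reflexive (sym (χ-∈ (K⊆J a∈K)))
  ... | no  _   = χ-nonneg J _

  -- indexed like the coefficients in σ, so that σ and σ′ agree without casts
  Coef : List (Subset n) → Set
  Coef Γ = Fin (length (map (χ P) Γ)) → ℚ

  NonNeg : ∀ {m} → (Fin m → ℚ) → Set
  NonNeg c = ∀ k → 0ℚ ≤ c k

  wsum : (Γ : List (Subset n)) → Coef Γ → (Subset n → ℚ) → ℚ
  wsum []      c g = 0ℚ
  wsum (I ∷ Γ) c g = c zero * g I + wsum Γ (c ∘ suc) g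

  σ′ : List (Subset n) → Vecℚ P → Set
  σ′ Γ x = Σ (Coef Γ) λ c → NonNeg c × (∀ a → x a ≡ wsum Γ c (λ J → χ P J a))

  ∑-wsum : ∀ Γ (c : Coef Γ) a →
    ∑ℚ (length (map (χ P) Γ)) (λ k → c k * L.lookup (map (χ P) Γ) k a) ≡ wsum Γ c (λ J → χ P J a)
  ∑-wsum []      c a = refl
  ∑-wsum (I ∷ Γ) c a = cong (c zero * χ P I a +_) (∑-wsum Γ (c ∘ suc) a)

  σ⇒σ′ : ∀ {Γ x} → σ P Γ x → σ′ Γ x
  σ⇒σ′ {Γ} (c , c≥0 , x≡) = c , c≥0 , λ a → trans (x≡ a) (∑-wsum Γ c a)

  σ′⇒σ : ∀ {Γ x} → σ′ Γ x → σ P Γ x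
  σ′⇒σ {Γ} (c , c≥0 , x≡) = c , c≥0 , λ a → trans (x≡ a) (sym (∑-wsum Γ c a))

  wsum-cong : ∀ Γ (c : Coef Γ) {g h} → (∀ J → J ∈L Γ → g J ≡ h J) → wsum Γ c g ≡ wsum Γ c h
  wsum-cong []      c g≗h = refl
  wsum-cong (I ∷ Γ) c g≗h =
    cong₂ _+_ (cong (c zero *_) (g≗h I (here refl))) (wsum-cong Γ (c ∘ suc) (λ J J∈ → g≗h J (there J∈)))

  wsum-mono : ∀ Γ (c : Coef Γ) {g h} → NonNeg c → (∀ J → J ∈L Γ → g J ≤ h J) →
              wsum Γ c g ≤ wsum Γ c h
  wsum-mono []      c c≥0 g≤h = QP.≤-refl
  wsum-mono (I ∷ Γ) c c≥0 g≤h =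
    QP.+-mono-≤ (*-monoˡ-≤-0≤ (c≥0 zero) (g≤h I (here refl)))
                (wsum-mono Γ (c ∘ suc) (c≥0 ∘ suc) (λ J J∈ → g≤h J (there J∈)))

  wsum-zeroʳ : ∀ Γ (c : Coef Γ) → wsum Γ c (λ _ → 0ℚ) ≡ 0ℚ
  wsum-zeroʳ []      c = refl
  wsum-zeroʳ (I ∷ Γ) c = trans (cong₂ _+_ (QP.*-zeroʳ (c zero)) (wsum-zeroʳ Γ (c ∘ suc))) (QP.+-identityˡ 0ℚ)

  wsum-zeroˡ : ∀ Γ g → wsum Γ (λ _ → 0ℚ) g ≡ 0ℚ
  wsum-zeroˡ []      g = refl
  wsum-zeroˡ (I ∷ Γ) g = trans (cong₂ _+_ (QP.*-zeroˡ (g I)) (wsum-zeroˡ Γ g)) (QP.+-identityˡ 0ℚ)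

  wsum-nonneg : ∀ Γ (c : Coef Γ) {g} → NonNeg c → (∀ J → J ∈L Γ → 0ℚ ≤ g J) → 0ℚ ≤ wsum Γ c g
  wsum-nonneg Γ c c≥0 g≥0 = subst (_≤ wsum Γ c _) (wsum-zeroʳ Γ c) (wsum-mono Γ c c≥0 g≥0)

  wsum-distrib-+ : ∀ Γ (c d : Coef Γ) g → wsum Γ (λ k → c k + d k) g ≡ wsum Γ c g + wsum Γ d g
  wsum-distrib-+ []      c d g = sym (QP.+-identityˡ 0ℚ)
  wsum-distrib-+ (I ∷ Γ) c d g =
    trans (cong ((c zero + d zero) * g I +_) (wsum-distrib-+ Γ (c ∘ suc) (d ∘ suc) g))
          (solve 5 (λ c d x G H → (c :+ d) :* x :+ (G :+ H) := (c :* x :+ G) :+ (d :* x :+ H)) refl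
                 (c zero) (d zero) (g I) (wsum Γ (c ∘ suc) g) (wsum Γ (d ∘ suc) g))
    where open +-*-Solver

  single : ∀ {Γ J} → J ∈L Γ → ℚ → Coef Γ
  single (here refl) r zero    = r
  single (here refl) r (suc k) = 0ℚ
  single (there J∈)  r zero    = 0ℚ
  single (there J∈)  r (suc k) = single J∈ r k

  single-nonneg : ∀ {Γ J} (J∈ : J ∈L Γ) {r} → 0ℚ ≤ r → NonNeg (single J∈ r)
  single-nonneg (here refl) r≥0 zero    = r≥0
  single-nonneg (here refl) r≥0 (suc k) = QP.≤-refl
  single-nonneg (there J∈)  r≥0 zero    = QP.≤-refl
  single-nonneg (there J∈)  r≥0 (suc k) = single-nonneg J∈ r≥0 k

  wsum-single : ∀ {Γ J} (J∈ : J ∈L Γ) r g → wsum Γ (single J∈ r) g ≡ r * g J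
  wsum-single {I ∷ Γ} (here refl) r g = trans (cong (r * g I +_) (wsum-zeroˡ Γ g)) (QP.+-identityʳ _)
  wsum-single {I ∷ Γ} (there J∈)  r g =
    trans (cong₂ _+_ (QP.*-zeroˡ (g I)) (wsum-single J∈ r g)) (QP.+-identityˡ _)

  coefAt : ∀ {Γ J} → J ∈L Γ → Coef Γ → ℚ
  coefAt (here _)  c = c zero
  coefAt (there p) c = coefAt p (c ∘ suc)

  coefAt-nonneg : ∀ {Γ J} (p : J ∈L Γ) (c : Coef Γ) → NonNeg c → 0ℚ ≤ coefAt p c
  coefAt-nonneg (here _)  c c≥0 = c≥0 zero
  coefAt-nonneg (there p) c c≥0 = coefAt-nonneg p (c ∘ suc) (c≥0 ∘ suc)

  term≤wsum : ∀ Γ (c : Coef Γ) {g} → NonNeg c → (∀ J → J ∈L Γ → 0ℚ ≤ g J) →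
              ∀ {J} (p : J ∈L Γ) → coefAt p c * g J ≤ wsum Γ c g
  term≤wsum (I ∷ Γ) c {g} c≥0 g≥0 (here refl) =
    subst (_≤ c zero * g I + wsum Γ (c ∘ suc) g) (QP.+-identityʳ _)
          (QP.+-monoʳ-≤ (c zero * g I) (wsum-nonneg Γ (c ∘ suc) (c≥0 ∘ suc) (λ J J∈ → g≥0 J (there J∈))))
  term≤wsum (I ∷ Γ) c {g} c≥0 g≥0 (there p) =
    subst (_≤ c zero * g I + wsum Γ (c ∘ suc) g) (QP.+-identityˡ _)
          (QP.+-mono-≤ (0≤* (c≥0 zero) (g≥0 I (here refl)))
                       (term≤wsum Γ (c ∘ suc) (c≥0 ∘ suc) (λ J J∈ → g≥0 J (there J∈)) p))

  wsum≡0⇒term≡0 : ∀ Γ (c : Coef Γ) {g} → NonNeg c → (∀ J → J ∈L Γ → 0ℚ ≤ g J) →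
                  wsum Γ c g ≡ 0ℚ → ∀ {J} (p : J ∈L Γ) → coefAt p c * g J ≡ 0ℚ
  wsum≡0⇒term≡0 Γ c {g} c≥0 g≥0 wsum≡0 {J} p =
    QP.≤-antisym (subst (coefAt p c * g J ≤_) wsum≡0 (term≤wsum Γ c c≥0 g≥0 p))
                 (0≤* (coefAt-nonneg p c c≥0) (g≥0 J p))

  term≡0⇒wsum≡0 : ∀ Γ (c : Coef Γ) {g} → (∀ {J} (p : J ∈L Γ) → coefAt p c * g J ≡ 0ℚ) →
                  wsum Γ c g ≡ 0ℚ
  term≡0⇒wsum≡0 []      c terms≡0 = refl
  term≡0⇒wsum≡0 (I ∷ Γ) c terms≡0 =
    trans (cong₂ _+_ (terms≡0 (here refl)) (term≡0⇒wsum≡0 Γ (c ∘ suc) (terms≡0 ∘ there)))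
          (QP.+-identityˡ 0ℚ)

  wsum-distrib-- : ∀ Γ (c : Coef Γ) g h → wsum Γ c (λ J → g J - h J) ≡ wsum Γ c g - wsum Γ c h
  wsum-distrib-- []      c g h = refl
  wsum-distrib-- (I ∷ Γ) c g h =
    trans (cong (c zero * (g I - h I) +_) (wsum-distrib-- Γ (c ∘ suc) g h))
          (solve 5 (λ c x y G H → c :* (x :- y) :+ (G :- H) := (c :* x :+ G) :- (c :* y :+ H)) refl
                 (c zero) (g I) (h I) (wsum Γ (c ∘ suc) g) (wsum Γ (c ∘ suc) h))
    where open +-*-Solver

  reweight : ∀ Γ Δ (c : Coef Γ) → NonNeg c → (∀ {J} (p : J ∈L Γ) → coefAt p c ≡ 0ℚ ⊎ J ∈L Δ) →
             Σ (Coef Δ) λ d → NonNeg d × (∀ g → wsum Δ d g ≡ wsum Γ c g)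
  reweight []      Δ c c≥0 kept = (λ _ → 0ℚ) , (λ _ → QP.≤-refl) , wsum-zeroˡ Δ
  reweight (I ∷ Γ) Δ c c≥0 kept with reweight Γ Δ (c ∘ suc) (c≥0 ∘ suc) (kept ∘ there) | kept (here refl)
  ... | d , d≥0 , d≡ | inj₁ c₀≡0 =
    d , d≥0 , λ g → begin
      wsum Δ d g                          ≡⟨ d≡ g ⟩
      wsum Γ (c ∘ suc) g                  ≡⟨ QP.+-identityˡ _ ⟨
      0ℚ + wsum Γ (c ∘ suc) g             ≡⟨ cong (_+ wsum Γ (c ∘ suc) g) (QP.*-zeroˡ (g I)) ⟨
      0ℚ * g I + wsum Γ (c ∘ suc) g       ≡⟨ cong (λ r → r * g I + wsum Γ (c ∘ suc) g) c₀≡0 ⟨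
      c zero * g I + wsum Γ (c ∘ suc) g   ∎
    where open ≡.≡-Reasoning
  ... | d , d≥0 , d≡ | inj₂ I∈Δ =
    (λ k → d k + single I∈Δ (c zero) k) ,
    (λ k → QP.+-mono-≤ (d≥0 k) (single-nonneg I∈Δ (c≥0 zero) k)) ,
    λ g → begin
      wsum Δ (λ k → d k + single I∈Δ (c zero) k) g   ≡⟨ wsum-distrib-+ Δ d (single I∈Δ (c zero)) g ⟩
      wsum Δ d g + wsum Δ (single I∈Δ (c zero)) g    ≡⟨ cong₂ _+_ (d≡ g) (wsum-single I∈Δ (c zero) g) ⟩
      wsum Γ (c ∘ suc) g + c zero * g I              ≡⟨ QP.+-comm _ (c zero * g I) ⟩
      c zero * g I + wsum Γ (c ∘ suc) g              ∎
    where open ≡.≡-Reasoning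

  σ-χ : ∀ {Γ J} → J ∈L Γ → σ P Γ (χ P J)
  σ-χ {Γ} {J} J∈ =
    σ′⇒σ {Γ} (single J∈ 1ℚ , single-nonneg J∈ 0≤1 ,
              λ a → sym (trans (wsum-single J∈ 1ℚ (λ K → χ P K a)) (QP.*-identityˡ _)))

  σ⊆C : ∀ Γ → IsNearChain P Γ → ∀ f → σ P Γ f → InC P f
  σ⊆C Γ (irreducible , _ , _) f s with σ⇒σ′ {Γ} s
  ... | c , c≥0 , f≡ =
    (λ a → subst (0ℚ ≤_) (sym (f≡ a)) (wsum-nonneg Γ c c≥0 (λ J _ → χ-nonneg J a))) ,
    (λ a b a≼b → subst₂ _≤_ (sym (f≡ a)) (sym (f≡ b))
                   (wsum-mono Γ c c≥0 (λ J J∈ → χ-mono (proj₁ (All.lookup irreducible J∈)) a b a≼b)))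

  dot : Vecℚ P → Vecℚ P → ℚ
  dot = _·_ P

  dot-congʳ : ∀ u {x y : Vecℚ P} → (∀ a → x a ≡ y a) → dot u x ≡ dot u y
  dot-congʳ u x≗y = ∑ℚ-cong n (λ a → cong (u a *_) (x≗y a))

  dot-wsum : ∀ u Γ (c : Coef Γ) →
             dot u (λ a → wsum Γ c (λ J → χ P J a)) ≡ wsum Γ c (λ J → dot u (χ P J))
  dot-wsum u []      c = trans (∑ℚ-cong n (λ a → QP.*-zeroʳ (u a))) (∑ℚ-zero n)
  dot-wsum u (I ∷ Γ) c = begin
    ∑ℚ n (λ a → u a * (c zero * χ P I a + rest a))
      ≡⟨ ∑ℚ-cong n (λ a → distrib (u a) (c zero) (χ P I a) (rest a)) ⟩
    ∑ℚ n (λ a → c zero * (u a * χ P I a) + u a * rest a)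
      ≡⟨ ∑ℚ-distrib-+ n _ _ ⟩
    ∑ℚ n (λ a → c zero * (u a * χ P I a)) + dot u rest
      ≡⟨ cong₂ _+_ (*-distribˡ-∑ℚ n (c zero) _) (dot-wsum u Γ (c ∘ suc)) ⟩
    c zero * dot u (χ P I) + wsum Γ (c ∘ suc) (λ J → dot u (χ P J)) ∎
    where
    open ≡.≡-Reasoning
    open +-*-Solver
    rest = λ a → wsum Γ (c ∘ suc) (λ J → χ P J a)
    distrib : ∀ u c x r → u * (c * x + r) ≡ c * (u * x) + u * r
    distrib = solve 4 (λ u c x r → u :* (c :* x :+ r) := c :* (u :* x) :+ u :* r) refl

  dot-σ′ : ∀ u {Γ x} ((c , _ , _) : σ′ Γ x) → dot u x ≡ wsum Γ c (λ J → dot u (χ P J))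
  dot-σ′ u {Γ} (c , _ , x≡) = trans (dot-congʳ u x≡) (dot-wsum u Γ c)

  unit : Fin n → Vecℚ P
  unit q = χ P ⁅ q ⁆

  dot-unit : ∀ q x → dot (unit q) x ≡ x q
  dot-unit q x = begin
    ∑ℚ n (λ a → unit q a * x a)  ≡⟨ ∑ℚ-single n _ q off-q ⟩
    unit q q * x q               ≡⟨ cong (_* x q) (χ-∈ (x∈⁅x⁆ q)) ⟩
    1ℚ * x q                     ≡⟨ QP.*-identityˡ (x q) ⟩
    x q                          ∎
    where
    open ≡.≡-Reasoning
    off-q : ∀ a → a ≢ q → unit q a * x a ≡ 0ℚ
    off-q a a≢q = trans (cong (_* x a) (χ-∉ (a≢q ∘ x∈⁅y⁆⇒x≡y q))) (QP.*-zeroˡ (x a))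

  dot-zeroˡ : ∀ x → dot (λ _ → 0ℚ) x ≡ 0ℚ
  dot-zeroˡ x = trans (∑ℚ-cong n (λ a → QP.*-zeroˡ (x a))) (∑ℚ-zero n)

  dot-+ˡ : ∀ v w x → dot (λ a → v a + w a) x ≡ dot v x + dot w x
  dot-+ˡ v w x = trans (∑ℚ-cong n (λ a → QP.*-distribʳ-+ (x a) (v a) (w a))) (∑ℚ-distrib-+ n _ _)

  dot--ˡ : ∀ v w x → dot (λ a → v a - w a) x ≡ dot v x - dot w x
  dot--ˡ v w x = begin
    dot (λ a → v a - w a) x                              ≡⟨ ∑ℚ-cong n (λ a → split (v a) (w a) (x a)) ⟩
    ∑ℚ n (λ a → v a * x a + (- 1ℚ) * (w a * x a))        ≡⟨ ∑ℚ-distrib-+ n _ _ ⟩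
    dot v x + ∑ℚ n (λ a → (- 1ℚ) * (w a * x a))
      ≡⟨ cong (dot v x +_) (*-distribˡ-∑ℚ n (- 1ℚ) _) ⟩
    dot v x + (- 1ℚ) * dot w x
      ≡⟨ solve 2 (λ p q → p :+ (:- con 1ℚ) :* q := p :- q) refl (dot v x) (dot w x) ⟩
    dot v x - dot w x                                    ∎
    where
    open ≡.≡-Reasoning
    open +-*-Solver
    split : ∀ p q r → (p - q) * r ≡ p * r + (- 1ℚ) * (q * r)
    split = solve 3 (λ p q r → (p :- q) :* r := p :* r :+ (:- con 1ℚ) :* (q :* r)) refl

  dot-unit-diff : ∀ q r x → dot (λ a → unit q a - unit r a) x ≡ x q - x r
  dot-unit-diff q r x = trans (dot--ˡ (unit q) (unit r) x) (cong₂ _-_ (dot-unit q x) (dot-unit r x))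

  -- Faces of the cones σ Γ

  σ-face : ∀ Γ → IsNearChain P Γ → ∀ u → Supports P u (σ P Γ) →
           ∃[ Δ ] IsNearChain P Δ × FaceBy P u (σ P Γ) (σ P Δ)
  σ-face Γ (irreducible , unique , nested) u supports =
    Δ , (All.tabulate (All.lookup irreducible ∘ Δ⊆Γ) , UniqueP.filter⁺ onHyperplane? unique ,
         λ I∈ J∈ → nested (Δ⊆Γ I∈) (Δ⊆Γ J∈)) ,
    supports , λ x → face⇒ x , face⇐ x
    where
    onHyperplane? = λ J → dot u (χ P J) QP.≟ 0ℚ
    Δ = L.filter onHyperplane? Γ
    Δ⊆Γ : ∀ {J} → J ∈L Δ → J ∈L Γ
    Δ⊆Γ J∈ = proj₁ (MP.∈-filter⁻ onHyperplane? {xs = Γ} J∈)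
    u·χ≥0 : ∀ J → J ∈L Γ → 0ℚ ≤ dot u (χ P J)
    u·χ≥0 J J∈ = supports (χ P J) (σ-χ J∈)
    face⇒ : ∀ x → σ P Δ x → σ P Γ x × dot u x ≡ 0ℚ
    face⇒ x s with σ⇒σ′ {Δ} s
    ... | s′@(d , d≥0 , x≡) with reweight Δ Γ d d≥0 (λ J∈ → inj₂ (Δ⊆Γ J∈))
    ...   | c , c≥0 , c≡ =
      σ′⇒σ {Γ} (c , c≥0 , λ a → trans (x≡ a) (sym (c≡ (λ J → χ P J a)))) ,
      trans (dot-σ′ u {Δ} s′)
            (trans (wsum-cong Δ d (λ J J∈ → proj₂ (MP.∈-filter⁻ onHyperplane? {xs = Γ} J∈)))
                   (wsum-zeroʳ Δ d))
    face⇐ : ∀ x → σ P Γ x × dot u x ≡ 0ℚ → σ P Δ x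
    face⇐ x (s , u·x≡0) with σ⇒σ′ {Γ} s
    ... | s′@(c , c≥0 , x≡) with reweight Γ Δ c c≥0 kept
      where
      kept : ∀ {J} (p : J ∈L Γ) → coefAt p c ≡ 0ℚ ⊎ J ∈L Δ
      kept {J} p with onHyperplane? J
      ... | yes u·χ≡0 = inj₂ (MP.∈-filter⁺ onHyperplane? p u·χ≡0)
      ... | no  u·χ≢0 =
        inj₁ (p*q≡0⇒p≡0 (coefAt-nonneg p c c≥0) (≤∧≢⇒< (u·χ≥0 J p) (u·χ≢0 ∘ sym))
                        (wsum≡0⇒term≡0 Γ c c≥0 u·χ≥0 (trans (sym (dot-σ′ u {Γ} s′)) u·x≡0) p))
    ...   | d , d≥0 , d≡ = σ′⇒σ {Δ} (d , d≥0 , λ a → trans (x≡ a) (sym (d≡ (λ J → χ P J a))))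

  -- Covering C(P)

  supp : Vecℚ P → Subset n
  supp f = subset (λ a → 0ℚ QP.<? f a)

  ∈-supp⁻ : ∀ f {a} → a ∈ supp f → 0ℚ < f a
  ∈-supp⁻ f = ∈-subset⁻ (λ a → 0ℚ QP.<? f a)

  ∈-supp⁺ : ∀ f {a} → 0ℚ < f a → a ∈ supp f
  ∈-supp⁺ f = ∈-subset⁺ (λ a → 0ℚ QP.<? f a)

  -- for an upper set S these are the unions of connected components of S
  record IsBlockOf (S U : Subset n) : Set where
    field
      ⊆S           : U ⊆ S
      nonempty     : Nonempty P U
      upper        : IsUpperSet P U
      downClosedIn : ∀ a b → a ≼ b → b ∈ U → a ∈ S → a ∈ U

  block? : ∀ S U → Dec (IsBlockOf S U)
  block? S U =
    map′ (λ (⊆S , ne , up , dc) →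
            record { ⊆S = λ {a} → ⊆S {a} ; nonempty = ne ; upper = up ; downClosedIn = dc })
         (λ B → let open IsBlockOf B in (λ {a} → ⊆S {a}) , nonempty , upper , downClosedIn)
         (U ⊆? S ×-dec nonempty? U ×-dec upper? U ×-dec
          FP.all? λ a → FP.all? λ b → (a ≼? b) →-dec ((b ∈? U) →-dec ((a ∈? S) →-dec (a ∈? U))))

  IsMinimalBlockOf : Subset n → Subset n → Set
  IsMinimalBlockOf S I = IsBlockOf S I × (∀ W → IsBlockOf S W → ¬ W ⊂ I)

  minimal-block : ∀ {S U} → IsBlockOf S U → ∃ (IsMinimalBlockOf S)
  minimal-block {S} {U} = WF.All.wfRec ⊂-wellFounded 0ℓ Goal descend U
    where
    Goal : Subset n → Set
    Goal U = IsBlockOf S U → ∃ (IsMinimalBlockOf S)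
    descend : ∀ U → WfRec _⊂_ Goal U → Goal U
    descend U below U-block with anySubset? (λ W → block? S W ×-dec W ⊂? U)
    ... | yes (W , W-block , W⊂U) = below W⊂U W-block
    ... | no  ∄W                  = U , U-block , λ W W-block W⊂U → ∄W (W , W-block , W⊂U)

  minimal-block⇒irreducible : ∀ {S I} → IsMinimalBlockOf S I → IsIrreducible P I
  minimal-block⇒irreducible {S} {I} (I-block , minimal) = upper , nonempty , no-split
    where
    open IsBlockOf I-block
    no-split : ¬ (Σ (Subset n) λ V → Σ (Subset n) λ W → IsUpperSet P V × IsUpperSet P W ×
                  Nonempty P V × Nonempty P W × Disjoint P V W × IsUnionOf P I V W)
    no-split (V , W , upper-V , upper-W , ∃v , (w , w∈W) , disjoint , union) = minimal V V-block V⊂I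
      where
      V⊆I : V ⊆ I
      V⊆I {a} a∈V = proj₂ (union a) (inj₁ a∈V)
      V-block : IsBlockOf S V
      V-block = record { ⊆S = ⊆S ∘ V⊆I ; nonempty = ∃v ; upper = upper-V ; downClosedIn = downClosed }
        where
        downClosed : ∀ a b → a ≼ b → b ∈ V → a ∈ S → a ∈ V
        downClosed a b a≼b b∈V a∈S with proj₁ (union a) (downClosedIn a b a≼b (V⊆I b∈V) a∈S)
        ... | inj₁ a∈V = a∈V
        ... | inj₂ a∈W = ⊥-elim (disjoint b b∈V (upper-W a b a≼b a∈W))
      V⊂I : V ⊂ I
      V⊂I = V⊆I , w , proj₂ (union w) (inj₂ w∈W) , λ w∈V → disjoint w w∈V w∈W

  irreducible-⊆⊎disjoint : ∀ {I J} → IsIrreducible P J → IsUpperSet P I →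
    (∀ a b → a ∈ J → a ∉ I → a ≼ b → b ∈ J → b ∈ I → ⊥) → J ⊆ I ⊎ Disjoint P J I
  irreducible-⊆⊎disjoint {I} {J} J-irreducible upper-I J∖I-upper =
    conclude (irreducible-indecomposable J-irreducible upper-J∩I (proj₁ ∘ ∈-subset⁻ J∩I?) J∖J∩I-upper)
    where
    J∩I? = λ a → (a ∈? J) ×-dec (a ∈? I)
    upper-J∩I : IsUpperSet P (subset J∩I?)
    upper-J∩I a b a≼b a∈ with ∈-subset⁻ J∩I? a∈
    ... | a∈J , a∈I = ∈-subset⁺ J∩I? (proj₁ J-irreducible a b a≼b a∈J , upper-I a b a≼b a∈I)
    J∖J∩I-upper : ∀ a b → a ∈ J → a ∉ subset J∩I? → a ≼ b → b ∈ subset J∩I? → ⊥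
    J∖J∩I-upper a b a∈J a∉ a≼b b∈ with a ∈? I | ∈-subset⁻ J∩I? b∈
    ... | yes a∈I | _           = a∉ (∈-subset⁺ J∩I? (a∈J , a∈I))
    ... | no  a∉I | b∈J , b∈I = J∖I-upper a b a∈J a∉I a≼b b∈J b∈I
    conclude : (∀ a → a ∉ subset J∩I?) ⊎ J ⊆ subset J∩I? → J ⊆ I ⊎ Disjoint P J I
    conclude (inj₁ empty)   = inj₂ (λ a a∈J a∈I → empty a (∈-subset⁺ J∩I? (a∈J , a∈I)))
    conclude (inj₂ J⊆J∩I) = inj₁ (λ a∈J → proj₂ (∈-subset⁻ J∩I? (J⊆J∩I a∈J)))

  irreducible-nested-in-block : ∀ {S I J} → IsBlockOf S I → IsIrreducible P J → J ⊆ S →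
                                J ⊆ I ⊎ Disjoint P J I
  irreducible-nested-in-block I-block J-irreducible J⊆S =
    irreducible-⊆⊎disjoint J-irreducible upper
      (λ a b a∈J a∉I a≼b _ b∈I → a∉I (downClosedIn a b a≼b b∈I (J⊆S a∈J)))
    where open IsBlockOf I-block

  supp-block : ∀ {f} → InC P f → Nonempty P (supp f) → IsBlockOf (supp f) (supp f)
  supp-block {f} (_ , mono) ne = record
    { ⊆S = id ; nonempty = ne ; downClosedIn = λ _ _ _ _ a∈S → a∈S
    ; upper = λ a b a≼b a∈S → ∈-supp⁺ f (QP.<-≤-trans (∈-supp⁻ f a∈S) (mono a b a≼b)) }

  Covering : Vecℚ P → Set
  Covering f = Σ (List (Subset n)) λ Γ → IsNearChain P Γ × σ′ Γ f × (∀ J → J ∈L Γ → J ⊆ supp f)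

  module Peel {f : Vecℚ P} (f∈C : InC P f) {I} (I-minimal : IsMinimalBlockOf (supp f) I)
              {p} (p∈I : p ∈ I) (p-min : ∀ a → a ∈ I → f p ≤ f a) where
    open IsBlockOf (proj₁ I-minimal)

    f′ : Vecℚ P
    f′ a = f a - f p * χ P I a

    f′-∈ : ∀ {a} → a ∈ I → f′ a ≡ f a - f p
    f′-∈ {a} a∈I = trans (cong (λ t → f a - f p * t) (χ-∈ a∈I)) (cong (_-_ (f a)) (QP.*-identityʳ (f p)))

    f′-∉ : ∀ {a} → a ∉ I → f′ a ≡ f a
    f′-∉ {a} a∉I = begin
      f a - f p * χ P I a   ≡⟨ cong (λ t → f a - f p * t) (χ-∉ a∉I) ⟩
      f a - f p * 0ℚ        ≡⟨ solve 2 (λ x y → x :- y :* con 0ℚ := x) refl (f a) (f p) ⟩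
      f a                   ∎
      where
      open ≡.≡-Reasoning
      open +-*-Solver

    f≡ : ∀ a → f a ≡ f p * χ P I a + f′ a
    f≡ a = solve 2 (λ x y → x := y :+ (x :- y)) refl (f a) (f p * χ P I a)
      where open +-*-Solver

    f′∈C : InC P f′
    f′∈C = nonneg , mono
      where
      nonneg : ∀ a → 0ℚ ≤ f′ a
      nonneg a with a ∈? I
      ... | yes a∈I = subst (0ℚ ≤_) (sym (f′-∈ a∈I)) (p≤q⇒0≤q-p (p-min a a∈I))
      ... | no  a∉I = subst (0ℚ ≤_) (sym (f′-∉ a∉I)) (proj₁ f∈C a)
      f≡0-below : ∀ a b → a ≼ b → a ∉ I → b ∈ I → f a ≡ 0ℚ
      f≡0-below a b a≼b a∉I b∈I =
        0≤∧≯0⇒≡0 (proj₁ f∈C a) (λ fa>0 → a∉I (downClosedIn a b a≼b b∈I (∈-supp⁺ f fa>0)))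
      mono : ∀ a b → a ≼ b → f′ a ≤ f′ b
      mono a b a≼b with a ∈? I | b ∈? I
      ... | yes a∈I | yes b∈I =
        subst₂ _≤_ (sym (f′-∈ a∈I)) (sym (f′-∈ b∈I)) (QP.+-monoˡ-≤ (- f p) (proj₂ f∈C a b a≼b))
      ... | yes a∈I | no  b∉I = ⊥-elim (b∉I (upper a b a≼b a∈I))
      ... | no  a∉I | yes b∈I =
        subst (_≤ f′ b) (sym (trans (f′-∉ a∉I) (f≡0-below a b a≼b a∉I b∈I))) (nonneg b)
      ... | no  a∉I | no  b∉I = subst₂ _≤_ (sym (f′-∉ a∉I)) (sym (f′-∉ b∉I)) (proj₂ f∈C a b a≼b)

    supp-f′⊆ : supp f′ ⊆ supp f
    supp-f′⊆ {a} a∈ with a ∈? I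
    ... | yes a∈I = ⊆S a∈I
    ... | no  a∉I = ∈-supp⁺ f (subst (0ℚ <_) (f′-∉ a∉I) (∈-supp⁻ f′ a∈))

    p∉supp-f′ : p ∉ supp f′
    p∉supp-f′ p∈ = QP.<-irrefl (sym (trans (f′-∈ p∈I) (QP.+-inverseʳ (f p)))) (∈-supp⁻ f′ p∈)

    supp-f′⊂ : supp f′ ⊂ supp f
    supp-f′⊂ = supp-f′⊆ , p , ⊆S p∈I , p∉supp-f′

    extend : Covering f′ → Covering f
    extend (Γ , (irreducible , unique , nested) , (c , c≥0 , f′≡) , Γ⊆supp) =
      I ∷ Γ ,
      (minimal-block⇒irreducible I-minimal ∷ irreducible , I∉Γ ∷ unique , nested′) ,
      (coefs , coefs≥0 , λ a → trans (f≡ a) (cong (f p * χ P I a +_) (f′≡ a))) ,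
      λ { J (here refl) → ⊆S ; J (there J∈) → supp-f′⊆ ∘ Γ⊆supp J J∈ }
      where
      I∉Γ : All (I ≢_) Γ
      I∉Γ = All.tabulate (λ {J} J∈ I≡J → p∉supp-f′ (Γ⊆supp J J∈ (subst (p ∈_) I≡J p∈I)))
      nested-I : ∀ {J} → J ∈L Γ → J ⊆ I ⊎ Disjoint P J I
      nested-I {J} J∈ =
        irreducible-nested-in-block (proj₁ I-minimal) (All.lookup irreducible J∈) (supp-f′⊆ ∘ Γ⊆supp J J∈)
      nested′ : ∀ {J K} → J ∈L I ∷ Γ → K ∈L I ∷ Γ → J ⊆ K ⊎ K ⊆ J ⊎ Disjoint P J K
      nested′ (here refl) (here refl) = inj₁ id
      nested′ (here refl) (there K∈) with nested-I K∈
      ... | inj₁ K⊆I     = inj₂ (inj₁ K⊆I)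
      ... | inj₂ disjoint = inj₂ (inj₂ (λ a a∈I a∈K → disjoint a a∈K a∈I))
      nested′ (there J∈) (here refl) with nested-I J∈
      ... | inj₁ J⊆I     = inj₁ J⊆I
      ... | inj₂ disjoint = inj₂ (inj₂ disjoint)
      nested′ (there J∈) (there K∈) = nested J∈ K∈
      coefs : Coef (I ∷ Γ)
      coefs = f p FV.∷ c
      coefs≥0 : NonNeg coefs
      coefs≥0 zero    = QP.<⇒≤ (∈-supp⁻ f (⊆S p∈I))
      coefs≥0 (suc k) = c≥0 k

  covering′ : ∀ f → InC P f → Covering f
  covering′ = WF.All.wfRec (On.wellFounded supp ⊂-wellFounded) 0ℓ (λ f → InC P f → Covering f) step
    where
    step : ∀ f → WfRec (λ g h → supp g ⊂ supp h) (λ f → InC P f → Covering f) f → InC P f → Covering f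
    step f below f∈C with nonempty? (supp f)
    ... | no ∅ = [] , ([] , [] , λ ()) , ((λ ()) , (λ ()) , f≡0) , (λ _ ())
      where
      f≡0 : ∀ a → f a ≡ 0ℚ
      f≡0 a = 0≤∧≯0⇒≡0 (proj₁ f∈C a) (λ fa>0 → ∅ (a , ∈-supp⁺ f fa>0))
    ... | yes ne with minimal-block (supp-block f∈C ne)
    ...   | I , I-minimal with least QP.≤-totalPreorder f (_∈? I) (L.allFin n)
    ...     | inj₁ ∄p = ⊥-elim (∄p _ (MP.∈-allFin _) (proj₂ (IsBlockOf.nonempty (proj₁ I-minimal))))
    ...     | inj₂ (p , _ , p∈I , p-min) = extend (below supp-f′⊂ f′∈C)
      where open Peel f∈C I-minimal p∈I (λ a → p-min a (MP.∈-allFin a))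

  covering : ∀ f → InC P f → ∃[ Γ ] IsNearChain P Γ × σ P Γ f
  covering f f∈C with covering′ f f∈C
  ... | Γ , near-chain , f∈σ′ , _ = Γ , near-chain , σ′⇒σ {Γ} f∈σ′

  -- Near-chains: uniqueness of coefficients, private points and dual vectors

  SeparatesAt : Vecℚ P → Subset n → ℚ → Set
  SeparatesAt x I t =
    0ℚ < t × (∀ a → a ∈ I → t ≤ x a) × (∀ a b → a ∉ I → b ∈ I → a ≼ b → x a < t)

  SeparatesAt-resp-≗ : ∀ {x y I t} → (∀ a → x a ≡ y a) → SeparatesAt x I t → SeparatesAt y I t
  SeparatesAt-resp-≗ {t = t} x≗y (t>0 , t≤ , <t) =
    t>0 , (λ a a∈I → subst (t ≤_) (x≗y a) (t≤ a a∈I)) ,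
    (λ a b a∉I b∈I a≼b → subst (_< t) (x≗y a) (<t a b a∉I b∈I a≼b))

  module NearChain {Γ : List (Subset n)} (near-chain : IsNearChain P Γ) where

    irreducible : ∀ {J} → J ∈L Γ → IsIrreducible P J
    irreducible = All.lookup (proj₁ near-chain)

    upper : ∀ {J} → J ∈L Γ → IsUpperSet P J
    upper = proj₁ ∘ irreducible

    nonempty : ∀ {J} → J ∈L Γ → Nonempty P J
    nonempty = proj₁ ∘ proj₂ ∘ irreducible

    nested : ∀ {I J} → I ∈L Γ → J ∈L Γ → I ⊆ J ⊎ J ⊆ I ⊎ Disjoint P I J
    nested = proj₂ (proj₂ near-chain)

    combination : Coef Γ → Vecℚ P
    combination c a = wsum Γ c (λ J → χ P J a)

    level : Coef Γ → Subset n → ℚ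
    level c K = wsum Γ c [ K ⊆_]

    level≤ : ∀ (c : Coef Γ) → NonNeg c → ∀ {K a} → a ∈ K → level c K ≤ combination c a
    level≤ c c≥0 a∈K = wsum-mono Γ c c≥0 (λ J _ → [⊆]≤χ a∈K J)

    positive-coefficient-separates : ∀ (c : Coef Γ) → NonNeg c → ∀ {I} (p : I ∈L Γ) → 0ℚ < coefAt p c →
                                     SeparatesAt (combination c) I (level c I)
    positive-coefficient-separates c c≥0 {I} p c-pos = t>0 , (λ a → level≤ c c≥0) , below-I
      where
      coefAt≤t : coefAt p c ≤ level c I
      coefAt≤t = subst (_≤ level c I) (trans (cong (coefAt p c *_) ([⊆]-yes {I} {I} id)) (QP.*-identityʳ _))
                       (term≤wsum Γ c c≥0 (λ J _ → [⊆]-nonneg I J) p)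
      t>0 : 0ℚ < level c I
      t>0 = QP.<-≤-trans c-pos coefAt≤t
      below-I : ∀ a b → a ∉ I → b ∈ I → a ≼ b → combination c a < level c I
      below-I a b a∉I b∈I a≼b = 0<q-p⇒p<q (QP.<-≤-trans c-pos (begin
        coefAt p c                                            ≡⟨ QP.*-identityʳ _ ⟨
        coefAt p c * 1ℚ                                       ≡⟨ cong (coefAt p c *_) gap-I ⟨
        coefAt p c * gap I                                    ≤⟨ term≤wsum Γ c c≥0 gap≥0 p ⟩
        wsum Γ c gap                                          ≡⟨ wsum-distrib-- Γ c _ _ ⟩
        level c I - combination c a                           ∎))
        where
        open QP.≤-Reasoning
        gap : Subset n → ℚ
        gap J = [ I ⊆ J ] - χ P J a
        gap-I : gap I ≡ 1ℚ
        gap-I = cong₂ _-_ ([⊆]-yes {I} {I} id) (χ-∉ a∉I)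
        gap≥0 : ∀ J → J ∈L Γ → 0ℚ ≤ gap J
        gap≥0 J J∈ with a ∈? J
        ... | no a∉J = p≤q⇒0≤q-p (subst (_≤ [ I ⊆ J ]) (sym (χ-∉ a∉J)) ([⊆]-nonneg I J))
        ... | yes a∈J with nested p J∈
        ...   | inj₁ I⊆J             = p≤q⇒0≤q-p (QP.≤-reflexive (trans (χ-∈ a∈J) (sym ([⊆]-yes I⊆J))))
        ...   | inj₂ (inj₁ J⊆I)      = ⊥-elim (a∉I (J⊆I a∈J))
        ...   | inj₂ (inj₂ disjoint) = ⊥-elim (disjoint b b∈I (upper J∈ a b a≼b a∈J))

    smallest-container-level : ∀ (c : Coef Γ) → NonNeg c → ∀ {a} → 0ℚ < combination c a →
                               ∃[ K ] K ∈L Γ × a ∈ K × level c K ≡ combination c a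
    smallest-container-level c c≥0 {a} x>0 with smallest (a ∈?_) Γ
    ... | inj₁ none = ⊥-elim (QP.<-irrefl (sym x≡0) x>0)
      where
      x≡0 : combination c a ≡ 0ℚ
      x≡0 = trans (wsum-cong Γ c (λ J J∈ → χ-∉ (none J J∈))) (wsum-zeroʳ Γ c)
    ... | inj₂ (K , K∈ , a∈K , K-smallest) = K , K∈ , a∈K , wsum-cong Γ c [K⊆J]≡χ
      where
      [K⊆J]≡χ : ∀ J → J ∈L Γ → [ K ⊆ J ] ≡ χ P J a
      [K⊆J]≡χ J J∈ with a ∈? J
      ... | no a∉J = trans ([⊆]-no (λ K⊆J → a∉J (K⊆J a∈K))) (sym (χ-∉ a∉J))
      ... | yes a∈J with nested K∈ J∈
      ...   | inj₁ K⊆J             = trans ([⊆]-yes K⊆J) (sym (χ-∈ a∈J))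
      ...   | inj₂ (inj₂ disjoint) = ⊥-elim (disjoint a a∈K a∈J)
      ...   | inj₂ (inj₁ J⊆K) with ⊆⇒≡⊎⊂ J⊆K
      ...     | inj₁ refl = trans ([⊆]-yes {J} {J} id) (sym (χ-∈ a∈J))
      ...     | inj₂ J⊂K  = ⊥-elim (⊂⇒≱ J⊂K (K-smallest J J∈ a∈J))

    separated⇒∈ : ∀ (c : Coef Γ) → NonNeg c → ∀ {I t} → IsIrreducible P I →
                  SeparatesAt (combination c) I t → I ∈L Γ
    separated⇒∈ c c≥0 {I} {t} I-irreducible (t>0 , t≤ , <t) =
      conclude (largest (λ K → (q ∈? K) ×-dec (t QP.≤? level c K)) Γ)
      where
      q = proj₁ (proj₁ (proj₂ I-irreducible))
      q∈I = proj₂ (proj₁ (proj₂ I-irreducible))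
      container : ∀ {a} → a ∈ I → ∃[ K ] K ∈L Γ × a ∈ K × t ≤ level c K
      container {a} a∈I with smallest-container-level c c≥0 (QP.<-≤-trans t>0 (t≤ a a∈I))
      ... | K , K∈ , a∈K , level≡ = K , K∈ , a∈K , subst (t ≤_) (sym level≡) (t≤ a a∈I)
      conclude : Largest (λ K → q ∈ K × t ≤ level c K) Γ → I ∈L Γ
      conclude (inj₁ none) = let (K , K∈ , q∈K , t≤K) = container q∈I in ⊥-elim (none K K∈ (q∈K , t≤K))
      conclude (inj₂ (J , J∈ , (q∈J , t≤J) , J-largest)) = subst (_∈L Γ) (⊆-antisym J⊆I I⊆J) J∈
        where
        J⊆I : J ⊆ I
        J⊆I with irreducible-⊆⊎disjoint (irreducible J∈) (proj₁ I-irreducible) J∖I-upper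
          where
          J∖I-upper : ∀ a b → a ∈ J → a ∉ I → a ≼ b → b ∈ J → b ∈ I → ⊥
          J∖I-upper a b a∈J a∉I a≼b _ b∈I =
            QP.<-irrefl refl (QP.<-≤-trans (<t a b a∉I b∈I a≼b) (QP.≤-trans t≤J (level≤ c c≥0 a∈J)))
        ... | inj₁ J⊆I     = J⊆I
        ... | inj₂ disjoint = ⊥-elim (disjoint q q∈J q∈I)
        I∖J-upper : ∀ a b → a ∈ I → a ∉ J → a ≼ b → b ∈ J → ⊥
        I∖J-upper a b a∈I a∉J a≼b b∈J with container a∈I
        ... | K , K∈ , a∈K , t≤K with nested K∈ J∈
        ...   | inj₁ K⊆J             = a∉J (K⊆J a∈K)
        ...   | inj₂ (inj₂ disjoint) = disjoint b (upper K∈ a b a≼b a∈K) b∈J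
        ...   | inj₂ (inj₁ J⊆K)      = ⊂⇒≱ (J⊆K , a , a∈K , a∉J) (J-largest K K∈ (J⊆K q∈J , t≤K))
        I⊆J : I ⊆ J
        I⊆J with irreducible-indecomposable I-irreducible (upper J∈) J⊆I I∖J-upper
        ... | inj₁ empty = ⊥-elim (empty q q∈J)
        ... | inj₂ I⊆J  = I⊆J

    IsPrivate : Subset n → Fin n → Set
    IsPrivate I q = q ∈ I × All (λ J → q ∈ J → I ⊆ J) Γ

    private-point : ∀ {I} → I ∈L Γ → ∃ (IsPrivate I)
    private-point {I} I∈ with FP.any? (λ q → (q ∈? I) ×-dec All.all? (λ J → (q ∈? J) →-dec (I ⊆? J)) Γ)
    ... | yes found = found
    ... | no  ∄q    = ⊥-elim contradiction
      where
      strictly-below : ∀ {a} → a ∈ I → ∃[ J ] J ∈L Γ × a ∈ J × J ⊂ I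
      strictly-below {a} a∈I
        with find (¬All⇒Any¬ (λ J → (a ∈? J) →-dec (I ⊆? J)) Γ (λ all → ∄q (a , a∈I , all)))
      ... | J , J∈ , ¬[a∈J→I⊆J] with a ∈? J
      ...   | no  a∉J = ⊥-elim (¬[a∈J→I⊆J] (⊥-elim ∘ a∉J))
      ...   | yes a∈J with nested I∈ J∈
      ...     | inj₁ I⊆J             = ⊥-elim (¬[a∈J→I⊆J] (λ _ → I⊆J))
      ...     | inj₂ (inj₂ disjoint) = ⊥-elim (disjoint a a∈I a∈J)
      ...     | inj₂ (inj₁ J⊆I) with ⊆⇒≡⊎⊂ J⊆I
      ...       | inj₁ refl = ⊥-elim (¬[a∈J→I⊆J] (λ _ → id))
      ...       | inj₂ J⊂I  = J , J∈ , a∈J , J⊂I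
      contradiction : ⊥
      contradiction with largest (_⊂? I) Γ
      ... | inj₁ none =
        let (a , a∈I) = nonempty I∈ ; (J , J∈ , _ , J⊂I) = strictly-below a∈I in none J J∈ J⊂I
      ... | inj₂ (J₀ , J₀∈ , J₀⊂I , J₀-largest) =
        conclude (irreducible-indecomposable (irreducible I∈) (upper J₀∈) (proj₁ J₀⊂I) I∖J₀-upper)
        where
        I∖J₀-upper : ∀ a b → a ∈ I → a ∉ J₀ → a ≼ b → b ∈ J₀ → ⊥
        I∖J₀-upper a b a∈I a∉J₀ a≼b b∈J₀ with strictly-below a∈I
        ... | Ja , Ja∈ , a∈Ja , Ja⊂I with nested Ja∈ J₀∈
        ...   | inj₁ Ja⊆J₀             = a∉J₀ (Ja⊆J₀ a∈Ja)
        ...   | inj₂ (inj₂ disjoint)   = disjoint b (upper Ja∈ a b a≼b a∈Ja) b∈J₀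
        ...   | inj₂ (inj₁ J₀⊆Ja)      = ⊂⇒≱ (J₀⊆Ja , a , a∈Ja , a∉J₀) (J₀-largest Ja Ja∈ Ja⊂I)
        conclude : (∀ a → a ∉ J₀) ⊎ I ⊆ J₀ → ⊥
        conclude (inj₁ empty) = let (a , a∈J₀) = nonempty J₀∈ in empty a a∈J₀
        conclude (inj₂ I⊆J₀)  = let (_ , a , a∈I , a∉J₀) = J₀⊂I in a∉J₀ (I⊆J₀ a∈I)

    Parent : Subset n → Set
    Parent I = (∀ J → J ∈L Γ → ¬ I ⊂ J) ⊎
               (∃[ K ] K ∈L Γ × I ⊂ K × (∀ J → J ∈L Γ → I ⊂ J → K ⊆ J))

    parent : ∀ {I} → I ∈L Γ → Parent I
    parent {I} I∈ with smallest (I ⊂?_) Γ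
    ... | inj₁ none = inj₁ none
    ... | inj₂ (K , K∈ , I⊂K , K-smallest) = inj₂ (K , K∈ , I⊂K , K⊆)
      where
      K⊆ : ∀ J → J ∈L Γ → I ⊂ J → K ⊆ J
      K⊆ J J∈ I⊂J with nested J∈ K∈
      ... | inj₂ (inj₁ K⊆J)     = K⊆J
      ... | inj₂ (inj₂ disjoint) =
        let (a , a∈I) = nonempty I∈ in ⊥-elim (disjoint a (proj₁ I⊂J a∈I) (proj₁ I⊂K a∈I))
      ... | inj₁ J⊆K with ⊆⇒≡⊎⊂ J⊆K
      ...   | inj₁ refl = id
      ...   | inj₂ J⊂K  = ⊥-elim (⊂⇒≱ J⊂K (K-smallest J J∈ I⊂J))

    point : ∀ {I} → I ∈L Γ → Fin n
    point I∈ = proj₁ (private-point I∈)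

    point-∈ : ∀ {I} (I∈ : I ∈L Γ) → point I∈ ∈ I
    point-∈ I∈ = proj₁ (proj₂ (private-point I∈))

    point-∈⇒⊆ : ∀ {I J} (I∈ : I ∈L Γ) → J ∈L Γ → point I∈ ∈ J → I ⊆ J
    point-∈⇒⊆ I∈ J∈ = All.lookup (proj₂ (proj₂ (private-point I∈))) J∈

    point-∈⇒≡⊎⊂ : ∀ {I J} (I∈ : I ∈L Γ) → J ∈L Γ → point I∈ ∈ J → I ≡ J ⊎ I ⊂ J
    point-∈⇒≡⊎⊂ I∈ J∈ = ⊆⇒≡⊎⊂ ∘ point-∈⇒⊆ I∈ J∈

    point-injective : ∀ {I J} (I∈ : I ∈L Γ) (J∈ : J ∈L Γ) → point I∈ ≡ point J∈ → I ≡ J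
    point-injective {I} {J} I∈ J∈ pointI≡pointJ =
      ⊆-antisym (point-∈⇒⊆ I∈ J∈ (subst (_∈ J) (sym pointI≡pointJ) (point-∈ J∈)))
                (point-∈⇒⊆ J∈ I∈ (subst (_∈ I) pointI≡pointJ (point-∈ I∈)))

    point-∉-no-larger : ∀ {I J} (I∈ : I ∈L Γ) → J ∈L Γ → I ≢ J → ∣ J ∣ ℕ.≤ ∣ I ∣ → point I∈ ∉ J
    point-∉-no-larger I∈ J∈ I≢J ∣J∣≤∣I∣ pointI∈J with point-∈⇒≡⊎⊂ I∈ J∈ pointI∈J
    ... | inj₁ I≡J = I≢J I≡J
    ... | inj₂ I⊂J = ⊂⇒≱ I⊂J ∣J∣≤∣I∣

    -- for J ⊋ I both private points lie in J (K is the least such J), so the two terms cancel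
    dual′ : ∀ {I} → I ∈L Γ → Parent I → Vecℚ P
    dual′ I∈ (inj₁ _)              = unit (point I∈)
    dual′ I∈ (inj₂ (K , K∈ , _)) a = unit (point I∈) a - unit (point K∈) a

    dual : ∀ {I} → I ∈L Γ → Vecℚ P
    dual I∈ = dual′ I∈ (parent I∈)

    dot-dual′-self : ∀ {I} (I∈ : I ∈L Γ) (parent-I : Parent I) → dot (dual′ I∈ parent-I) (χ P I) ≡ 1ℚ
    dot-dual′-self {I} I∈ (inj₁ _) = trans (dot-unit (point I∈) (χ P I)) (χ-∈ (point-∈ I∈))
    dot-dual′-self {I} I∈ (inj₂ (K , K∈ , (_ , a , a∈K , a∉I) , _)) =
      trans (dot-unit-diff (point I∈) (point K∈) (χ P I)) (cong₂ _-_ (χ-∈ (point-∈ I∈)) (χ-∉ pointK∉I))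
      where
      pointK∉I : point K∈ ∉ I
      pointK∉I pointK∈I = a∉I (point-∈⇒⊆ K∈ I∈ pointK∈I a∈K)

    dot-dual′-other : ∀ {I J} (I∈ : I ∈L Γ) (parent-I : Parent I) → J ∈L Γ → J ≢ I →
                      dot (dual′ I∈ parent-I) (χ P J) ≡ 0ℚ
    dot-dual′-other {I} {J} I∈ (inj₁ no-parent) J∈ J≢I = trans (dot-unit (point I∈) (χ P J)) (χ-∉ pointI∉J)
      where
      pointI∉J : point I∈ ∉ J
      pointI∉J pointI∈J with point-∈⇒≡⊎⊂ I∈ J∈ pointI∈J
      ... | inj₁ I≡J = J≢I (sym I≡J)
      ... | inj₂ I⊂J = no-parent J J∈ I⊂J
    dot-dual′-other {I} {J} I∈ (inj₂ (K , K∈ , I⊂K , K-least)) J∈ J≢I =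
      trans (dot-unit-diff (point I∈) (point K∈) (χ P J)) values
      where
      values : χ P J (point I∈) - χ P J (point K∈) ≡ 0ℚ
      values with point I∈ ∈? J
      ... | yes pointI∈J with point-∈⇒≡⊎⊂ I∈ J∈ pointI∈J
      ...   | inj₁ I≡J = ⊥-elim (J≢I (sym I≡J))
      ...   | inj₂ I⊂J =
        trans (cong₂ _-_ (χ-∈ pointI∈J) (χ-∈ (K-least J J∈ I⊂J (point-∈ K∈)))) (QP.+-inverseʳ 1ℚ)
      values | no pointI∉J with point K∈ ∈? J
      ...   | yes pointK∈J = ⊥-elim (pointI∉J (point-∈⇒⊆ K∈ J∈ pointK∈J (proj₁ I⊂K (point-∈ I∈))))
      ...   | no  pointK∉J = cong₂ _-_ (χ-∉ pointI∉J) (χ-∉ pointK∉J)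

    dot-dual-self : ∀ {I} (I∈ : I ∈L Γ) → dot (dual I∈) (χ P I) ≡ 1ℚ
    dot-dual-self I∈ = dot-dual′-self I∈ (parent I∈)

    dot-dual-other : ∀ {I J} (I∈ : I ∈L Γ) → J ∈L Γ → J ≢ I → dot (dual I∈) (χ P J) ≡ 0ℚ
    dot-dual-other I∈ = dot-dual′-other I∈ (parent I∈)

    dual-sum : (L : List (Subset n)) → L ⊆ᴸ Γ → Vecℚ P
    dual-sum []      L⊆Γ _ = 0ℚ
    dual-sum (I ∷ L) L⊆Γ a = dual (L⊆Γ (here refl)) a + dual-sum L (L⊆Γ ∘ there) a

    dot-dual-sum-∉ : ∀ L (L⊆Γ : L ⊆ᴸ Γ) {J} → J ∈L Γ → J ∉L L →
                     dot (dual-sum L L⊆Γ) (χ P J) ≡ 0ℚ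
    dot-dual-sum-∉ []      L⊆Γ {J} J∈ J∉L = dot-zeroˡ (χ P J)
    dot-dual-sum-∉ (I ∷ L) L⊆Γ {J} J∈ J∉L =
      trans (dot-+ˡ (dual (L⊆Γ (here refl))) (dual-sum L (L⊆Γ ∘ there)) (χ P J))
            (cong₂ _+_ (dot-dual-other (L⊆Γ (here refl)) J∈ (J∉L ∘ here))
                       (dot-dual-sum-∉ L (L⊆Γ ∘ there) J∈ (J∉L ∘ there)))

    dot-dual-sum-∈ : ∀ L (L⊆Γ : L ⊆ᴸ Γ) → Unique L → ∀ {J} → J ∈L L →
                     dot (dual-sum L L⊆Γ) (χ P J) ≡ 1ℚ
    dot-dual-sum-∈ (I ∷ L) L⊆Γ (I∉L ∷ unique) {J} J∈ =
      trans (dot-+ˡ (dual I∈Γ) (dual-sum L (L⊆Γ ∘ there)) (χ P J)) (values J∈)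
      where
      I∈Γ = L⊆Γ (here refl)
      values : J ∈L I ∷ L → dot (dual I∈Γ) (χ P J) + dot (dual-sum L (L⊆Γ ∘ there)) (χ P J) ≡ 1ℚ
      values (here refl) =
        cong₂ _+_ (dot-dual-self I∈Γ)
                  (dot-dual-sum-∉ L (L⊆Γ ∘ there) I∈Γ (λ I∈L → All.lookup I∉L I∈L refl))
      values (there J∈L) =
        trans (cong₂ _+_ (dot-dual-other I∈Γ (L⊆Γ (there J∈L)) (λ J≡I → All.lookup I∉L J∈L (sym J≡I)))
                         (dot-dual-sum-∈ L (L⊆Γ ∘ there) unique J∈L))
              (QP.+-identityˡ 1ℚ)

    module _ (Δ : List (Subset n)) where

      private
        ∉Δ? = λ J → ¬? (J ∈ˢ? Δ)
        Γ∖Δ⊆Γ : L.filter ∉Δ? Γ ⊆ᴸ Γ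
        Γ∖Δ⊆Γ J∈ = proj₁ (MP.∈-filter⁻ ∉Δ? {xs = Γ} J∈)

      outside : Vecℚ P
      outside = dual-sum (L.filter ∉Δ? Γ) Γ∖Δ⊆Γ

      dot-outside-∈ : ∀ {J} → J ∈L Γ → J ∈L Δ → dot outside (χ P J) ≡ 0ℚ
      dot-outside-∈ J∈Γ J∈Δ =
        dot-dual-sum-∉ _ Γ∖Δ⊆Γ J∈Γ (λ J∈ → proj₂ (MP.∈-filter⁻ ∉Δ? {xs = Γ} J∈) J∈Δ)

      dot-outside-∉ : ∀ {J} → J ∈L Γ → J ∉L Δ → dot outside (χ P J) ≡ 1ℚ
      dot-outside-∉ J∈Γ J∉Δ =
        dot-dual-sum-∈ _ Γ∖Δ⊆Γ (UniqueP.filter⁺ ∉Δ? (proj₁ (proj₂ near-chain))) (MP.∈-filter⁺ ∉Δ? J∈Γ J∉Δ)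

      dot-outside-nonneg : ∀ J → J ∈L Γ → 0ℚ ≤ dot outside (χ P J)
      dot-outside-nonneg J J∈Γ with J ∈ˢ? Δ
      ... | yes J∈Δ = QP.≤-reflexive (sym (dot-outside-∈ J∈Γ J∈Δ))
      ... | no  J∉Δ = subst (0ℚ ≤_) (sym (dot-outside-∉ J∈Γ J∉Δ)) 0≤1

  -- Intersections of the cones σ Γ

  positive-coefficient-shared : ∀ {Γ Δ} → IsNearChain P Γ → IsNearChain P Δ →
                                ∀ {x} ((c , _ , _) : σ′ Γ x) → σ′ Δ x →
                                ∀ {I} (p : I ∈L Γ) → 0ℚ < coefAt p c → I ∈L Δ
  positive-coefficient-shared ncΓ ncΔ (c , c≥0 , x≡c) (d , d≥0 , x≡d) p c>0 =
    NearChain.separated⇒∈ ncΔ d d≥0 (NearChain.irreducible ncΓ p)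
      (SeparatesAt-resp-≗ (λ a → trans (sym (x≡c a)) (x≡d a))
                          (NearChain.positive-coefficient-separates ncΓ c c≥0 p c>0))

  intersection-face : ∀ Γ Δ → IsNearChain P Γ → IsNearChain P Δ →
                      IsFaceOf P (λ x → σ P Γ x × σ P Δ x) (σ P Γ)
  intersection-face Γ Δ ncΓ ncΔ = u , supports , λ x → face⇒ x , face⇐ x
    where
    open NearChain ncΓ using (outside; dot-outside-∈; dot-outside-∉; dot-outside-nonneg)
    u = outside Δ
    supports : Supports P u (σ P Γ)
    supports x s with σ⇒σ′ {Γ} s
    ... | s′@(c , c≥0 , _) = subst (0ℚ ≤_) (sym (dot-σ′ u {Γ} s′)) (wsum-nonneg Γ c c≥0 (dot-outside-nonneg Δ))
    face⇒ : ∀ x → σ P Γ x × σ P Δ x → σ P Γ x × dot u x ≡ 0ℚ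
    face⇒ x (sΓ , sΔ) = sΓ , trans (dot-σ′ u {Γ} s′) (term≡0⇒wsum≡0 Γ c term≡0)
      where
      s′ = σ⇒σ′ {Γ} sΓ
      c = proj₁ s′
      term≡0 : ∀ {J} (p : J ∈L Γ) → coefAt p c * dot u (χ P J) ≡ 0ℚ
      term≡0 {J} p with J ∈ˢ? Δ
      ... | yes J∈Δ = trans (cong (coefAt p c *_) (dot-outside-∈ Δ p J∈Δ)) (QP.*-zeroʳ (coefAt p c))
      ... | no  J∉Δ = trans (cong (_* dot u (χ P J)) coef≡0) (QP.*-zeroˡ (dot u (χ P J)))
        where
        coef≡0 : coefAt p c ≡ 0ℚ
        coef≡0 = 0≤∧≯0⇒≡0 (coefAt-nonneg p c (proj₁ (proj₂ s′)))
                          (J∉Δ ∘ positive-coefficient-shared ncΓ ncΔ s′ (σ⇒σ′ {Δ} sΔ) p)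
    face⇐ : ∀ x → σ P Γ x × dot u x ≡ 0ℚ → σ P Γ x × σ P Δ x
    face⇐ x (sΓ , u·x≡0) with reweight Γ Δ c c≥0 kept
      where
      s′ = σ⇒σ′ {Γ} sΓ
      c = proj₁ s′
      c≥0 = proj₁ (proj₂ s′)
      kept : ∀ {J} (p : J ∈L Γ) → coefAt p c ≡ 0ℚ ⊎ J ∈L Δ
      kept {J} p with J ∈ˢ? Δ
      ... | yes J∈Δ = inj₂ J∈Δ
      ... | no  J∉Δ =
        inj₁ (trans (sym (trans (cong (coefAt p c *_) (dot-outside-∉ Δ p J∉Δ)) (QP.*-identityʳ _)))
                    (wsum≡0⇒term≡0 Γ c c≥0 (dot-outside-nonneg Δ) (trans (sym (dot-σ′ u {Γ} s′)) u·x≡0) p))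
    ... | d , d≥0 , d≡ =
      sΓ , σ′⇒σ {Δ} (d , d≥0 , λ a → trans (proj₂ (proj₂ (σ⇒σ′ {Γ} sΓ)) a) (sym (d≡ (λ J → χ P J a))))

  -- Lattice bases and unimodularity

  unitℤ : Fin n → Vecℤ P
  unitℤ q = χℤ P ⁅ q ⁆

  unitℤ-refl : ∀ q → unitℤ q q ≡ 1ℤ
  unitℤ-refl q = χℤ-∈ (x∈⁅x⁆ q)

  unitℤ-≢ : ∀ {q a} → a ≢ q → unitℤ q a ≡ 0ℤ
  unitℤ-≢ {q} a≢q = χℤ-∉ (a≢q ∘ x∈⁅y⁆⇒x≡y q)

  comb : (B : List (Vecℤ P)) → (Fin (length B) → ℤ) → Vecℤ P
  comb B c a = ∑ℤ (length B) (λ k → c k *ℤ L.lookup B k a)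

  IsLatticeBasis-resp-↭ : ∀ {xs ys} → xs ↭ ys → IsLatticeBasis P xs → IsLatticeBasis P ys
  IsLatticeBasis-resp-↭ {xs} {ys} xs↭ys (span , indep) = span′ , indep′
    where
    π = PermSetoid.onIndices (↭⇒↭ₛ xs↭ys)
    lookup-π = PermSetoidP.onIndices-lookup (≡.setoid (Vecℤ P)) (↭⇒↭ₛ xs↭ys)
    reindex : ∀ {c d} → (∀ i → c (π ⟨$⟩ʳ i) ≡ d i) → ∀ a → comb ys c a ≡ comb xs d a
    reindex {c} {d} c∘π≗d a = begin
      ∑ℤ _ term                                               ≡⟨ ∑ℤ≡sum _ term ⟩
      ℤΣ.sum term                                             ≡⟨ ℤΣ.sum-permute term π ⟩
      ℤΣ.sum (λ i → c (π ⟨$⟩ʳ i) *ℤ L.lookup ys (π ⟨$⟩ʳ i) a)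
        ≡⟨ ℤΣ.sum-cong-≗ (λ i → cong₂ (λ x v → x *ℤ v a) (c∘π≗d i) (sym (lookup-π i))) ⟩
      ℤΣ.sum (λ i → d i *ℤ L.lookup xs i a)                   ≡⟨ ∑ℤ≡sum _ (λ i → d i *ℤ L.lookup xs i a) ⟨
      comb xs d a                                             ∎
      where
      open ≡.≡-Reasoning
      term = λ k → c k *ℤ L.lookup ys k a
    span′ : ∀ z → Σ (Fin (length ys) → ℤ) λ c → ∀ a → z a ≡ comb ys c a
    span′ z with span z
    ... | c , z≡ =
      c ∘ (π ⟨$⟩ˡ_) , λ a → trans (z≡ a) (sym (reindex {c ∘ (π ⟨$⟩ˡ_)} (λ i → cong c (inverseˡ π)) a))
    indep′ : ∀ c → (∀ a → comb ys c a ≡ 0ℤ) → ∀ k → c k ≡ 0ℤ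
    indep′ c c≡0 k = trans (cong c (sym (inverseʳ π))) (indep (c ∘ (π ⟨$⟩ʳ_)) c∘π≡0 (π ⟨$⟩ˡ k))
      where
      c∘π≡0 : ∀ a → comb xs (c ∘ (π ⟨$⟩ʳ_)) a ≡ 0ℤ
      c∘π≡0 a = trans (sym (reindex {c} (λ _ → refl) a)) (c≡0 a)

  comb-vanish : ∀ B c {p} → (∀ v → v ∈L B → v p ≡ 0ℤ) → comb B c p ≡ 0ℤ
  comb-vanish []      c vanish = refl
  comb-vanish (v ∷ B) c vanish =
    cong₂ _+ℤ_ (trans (cong (c zero *ℤ_) (vanish v (here refl))) (ZP.*-zeroʳ (c zero)))
              (comb-vanish B (c ∘ suc) (λ w w∈B → vanish w (there w∈B)))

  comb-pivot : ∀ b B c {p} → b p ≡ 1ℤ → (∀ v → v ∈L B → v p ≡ 0ℤ) → comb (b ∷ B) c p ≡ c zero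
  comb-pivot b B c {p} bp≡1 vanish = begin
    c zero *ℤ b p +ℤ comb B (c ∘ suc) p
      ≡⟨ cong₂ (λ x y → c zero *ℤ x +ℤ y) bp≡1 (comb-vanish B (c ∘ suc) vanish) ⟩
    c zero *ℤ 1ℤ +ℤ 0ℤ                    ≡⟨ trans (ZP.+-identityʳ _) (ZP.*-identityʳ _) ⟩
    c zero                                ∎
    where open ≡.≡-Reasoning

  comb-∷-zero : ∀ b B c a → c zero ≡ 0ℤ → comb (b ∷ B) c a ≡ comb B (c ∘ suc) a
  comb-∷-zero b B c a c₀≡0 = begin
    c zero *ℤ b a +ℤ comb B (c ∘ suc) a   ≡⟨ cong (λ x → x *ℤ b a +ℤ comb B (c ∘ suc) a) c₀≡0 ⟩
    0ℤ *ℤ b a +ℤ comb B (c ∘ suc) a       ≡⟨ cong (_+ℤ comb B (c ∘ suc) a) (ZP.*-zeroˡ (b a)) ⟩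
    0ℤ +ℤ comb B (c ∘ suc) a              ≡⟨ ZP.+-identityˡ _ ⟩
    comb B (c ∘ suc) a                    ∎
    where open ≡.≡-Reasoning

  Independent : List (Vecℤ P) → Set
  Independent B = ∀ c → (∀ a → comb B c a ≡ 0ℤ) → ∀ k → c k ≡ 0ℤ

  Independent-tail : ∀ {b B} → Independent (b ∷ B) → Independent B
  Independent-tail {b} {B} indep c c≡0 k =
    indep (0ℤ FV.∷ c) (λ a → trans (comb-∷-zero b B (0ℤ FV.∷ c) a refl) (c≡0 a)) (suc k)

  Independent-∷ : ∀ {b B p} → b p ≡ 1ℤ → (∀ v → v ∈L B → v p ≡ 0ℤ) → Independent B →
                  Independent (b ∷ B)
  Independent-∷ {b} {B} {p} bp≡1 vanish indep c c≡0 = λ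
    { zero    → c₀≡0
    ; (suc k) → indep (c ∘ suc) (λ a → trans (sym (comb-∷-zero b B c a c₀≡0)) (c≡0 a)) k }
    where
    c₀≡0 : c zero ≡ 0ℤ
    c₀≡0 = trans (sym (comb-pivot b B c bp≡1 vanish)) (c≡0 p)

  IsLatticeBasis-exchange : ∀ {b w B p} → IsLatticeBasis P (b ∷ B) → b p ≡ 1ℤ → w p ≡ 1ℤ →
                            (∀ v → v ∈L B → v p ≡ 0ℤ) → IsLatticeBasis P (w ∷ B)
  IsLatticeBasis-exchange {b} {w} {B} {p} (span , indep) bp≡1 wp≡1 vanish =
    span′ , Independent-∷ {w} {B} wp≡1 vanish (Independent-tail {b} {B} indep)
    where
    open ≡.≡-Reasoning
    open ℤSolver.+-*-Solver
    span′ : ∀ z → Σ (Fin (length (w ∷ B)) → ℤ) λ c → ∀ a → z a ≡ comb (w ∷ B) c a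
    span′ z = (z p FV.∷ c ∘ suc) , λ a → begin
        z a                                ≡⟨ solve 2 (λ x z → z := x :+ (z :- x)) refl (z p *ℤ w a) (z a) ⟩
        z p *ℤ w a +ℤ y a                  ≡⟨ cong (z p *ℤ w a +ℤ_) (trans (y≡ a) (comb-∷-zero b B c a c₀≡0)) ⟩
        z p *ℤ w a +ℤ comb B (c ∘ suc) a   ∎
      where
      y = λ a → z a -ℤ z p *ℤ w a
      c = proj₁ (span y)
      y≡ = proj₂ (span y)
      c₀≡0 : c zero ≡ 0ℤ
      c₀≡0 = begin
        c zero               ≡⟨ comb-pivot b B c bp≡1 vanish ⟨
        comb (b ∷ B) c p     ≡⟨ y≡ p ⟨
        z p -ℤ z p *ℤ w p    ≡⟨ cong (λ t → z p -ℤ z p *ℤ t) wp≡1 ⟩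
        z p -ℤ z p *ℤ 1ℤ     ≡⟨ solve 1 (λ x → x :- x :* con 1ℤ := con 0ℤ) refl (z p) ⟩
        0ℤ                   ∎

  IsLatticeBasis-units : ∀ R → Unique R → (∀ a → a ∈L R) → IsLatticeBasis P (map unitℤ R)
  IsLatticeBasis-units R unique covering =
    (λ z → coords R z , λ a → sym (comb-coords R unique (covering a))) , independent R unique
    where
    unit-vanish : ∀ {q R} → All (q ≢_) R → ∀ v → v ∈L map unitℤ R → v q ≡ 0ℤ
    unit-vanish q∉R v v∈ with MP.∈-map⁻ unitℤ v∈
    ... | r , r∈R , refl = unitℤ-≢ (All.lookup q∉R r∈R)
    coords : ∀ R → Vecℤ P → Fin (length (map unitℤ R)) → ℤ
    coords (q ∷ R) z zero    = z q
    coords (q ∷ R) z (suc k) = coords R z k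
    comb-coords : ∀ R → Unique R → ∀ {z a} → a ∈L R → comb (map unitℤ R) (coords R z) a ≡ z a
    comb-coords (q ∷ R) (q∉R ∷ unique) {z} (here refl) =
      comb-pivot (unitℤ q) (map unitℤ R) (coords (q ∷ R) z) (unitℤ-refl q) (unit-vanish q∉R)
    comb-coords (q ∷ R) (q∉R ∷ unique) {z} {a} (there a∈R) = begin
      z q *ℤ unitℤ q a +ℤ comb (map unitℤ R) (coords R z) a
        ≡⟨ cong₂ (λ x y → z q *ℤ x +ℤ y) (unitℤ-≢ a≢q) (comb-coords R unique a∈R) ⟩
      z q *ℤ 0ℤ +ℤ z a   ≡⟨ cong (_+ℤ z a) (ZP.*-zeroʳ (z q)) ⟩
      0ℤ +ℤ z a          ≡⟨ ZP.+-identityˡ (z a) ⟩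
      z a                ∎
      where
      open ≡.≡-Reasoning
      a≢q : a ≢ q
      a≢q a≡q = All.lookup q∉R a∈R (sym a≡q)
    independent : ∀ R → Unique R → Independent (map unitℤ R)
    independent []      []             c _ ()
    independent (q ∷ R) (q∉R ∷ unique) =
      Independent-∷ (unitℤ-refl q) (unit-vanish q∉R) (independent R unique)

  bySize : DecTotalOrder 0ℓ 0ℓ 0ℓ
  bySize = On.decTotalOrder (Flip.decTotalOrder ℕP.≤-decTotalOrder) (∣_∣ {n})

  module _ {Γ : List (Subset n)} (near-chain : IsNearChain P Γ) where
    open NearChain near-chain using (point; point-∈; point-injective; point-∉-no-larger)

    Free : (T : List (Subset n)) → T ⊆ᴸ Γ → Fin n → Set
    Free T T⊆Γ a = ∀ {J} (J∈ : J ∈L T) → a ≢ point (T⊆Γ J∈)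

    -- the standard basis with the unit vector at the private point of each J ∈ T replaced by χ J
    record BasisExtension (T : List (Subset n)) (T⊆Γ : T ⊆ᴸ Γ) : Set where
      field
        free-points : List (Fin n)
        unique      : Unique free-points
        sound       : ∀ {a} → a ∈L free-points → Free T T⊆Γ a
        complete    : ∀ a → Free T T⊆Γ a → a ∈L free-points
        basis       : IsLatticeBasis P (map (χℤ P) T ++ map unitℤ free-points)

    basis-extension-[] : (T⊆Γ : [] ⊆ᴸ Γ) → BasisExtension [] T⊆Γ
    basis-extension-[] _ = record
      { free-points = L.allFin n ; unique = UniqueP.allFin⁺ n ; sound = λ _ () ; complete = λ a _ → MP.∈-allFin a
      ; basis = IsLatticeBasis-units (L.allFin n) (UniqueP.allFin⁺ n) MP.∈-allFin }

    basis-extension-∷ : ∀ {I T} (T⊆Γ : I ∷ T ⊆ᴸ Γ) → All (I ≢_) T → All (λ J → ∣ J ∣ ℕ.≤ ∣ I ∣) T →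
                        BasisExtension T (T⊆Γ ∘ there) → BasisExtension (I ∷ T) T⊆Γ
    basis-extension-∷ {I} {T} T⊆Γ I∉T I-largest extension = record
      { free-points = R ; unique = AllPairs.tail q∷R-unique ; sound = sound′ ; complete = complete′
      ; basis = basis′ }
      where
      open BasisExtension extension renaming (free-points to R₀)
      I∈ = T⊆Γ (here refl)
      q = point I∈
      q-free : Free T (T⊆Γ ∘ there) q
      q-free J∈ q≡ = All.lookup I∉T J∈ (point-injective I∈ (T⊆Γ (there J∈)) q≡)
      R = proj₁ (∈⇒↭∷ (complete q q-free))
      R₀↭q∷R : R₀ ↭ q ∷ R
      R₀↭q∷R = proj₂ (∈⇒↭∷ (complete q q-free))
      q∷R-unique : Unique (q ∷ R)
      q∷R-unique = PermSetoidP.Unique-resp-↭ (≡.setoid (Fin n)) (↭⇒↭ₛ R₀↭q∷R) unique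
      q∉R : All (q ≢_) R
      q∉R = AllPairs.head q∷R-unique
      sound′ : ∀ {a} → a ∈L R → Free (I ∷ T) T⊆Γ a
      sound′ a∈R (here refl) a≡q = All.lookup q∉R a∈R (sym a≡q)
      sound′ a∈R (there J∈)     = sound (PermP.∈-resp-↭ (↭-sym R₀↭q∷R) (there a∈R)) J∈
      complete′ : ∀ a → Free (I ∷ T) T⊆Γ a → a ∈L R
      complete′ a a-free with PermP.∈-resp-↭ R₀↭q∷R (complete a (a-free ∘ there))
      ... | here a≡q  = ⊥-elim (a-free (here refl) a≡q)
      ... | there a∈R = a∈R
      rest = map (χℤ P) T ++ map unitℤ R
      reorder : map (χℤ P) T ++ map unitℤ R₀ ↭ unitℤ q ∷ rest
      reorder = ↭-trans (PermP.++⁺ˡ (map (χℤ P) T) (PermP.map⁺ unitℤ R₀↭q∷R))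
                        (PermP.shift (unitℤ q) (map (χℤ P) T) (map unitℤ R))
      vanish : ∀ v → v ∈L rest → v q ≡ 0ℤ
      vanish v v∈ with MP.∈-++⁻ (map (χℤ P) T) v∈
      ... | inj₁ v∈T with MP.∈-map⁻ (χℤ P) v∈T
      ...   | J , J∈ , refl =
        χℤ-∉ (point-∉-no-larger I∈ (T⊆Γ (there J∈)) (All.lookup I∉T J∈) (All.lookup I-largest J∈))
      vanish v v∈ | inj₂ v∈R with MP.∈-map⁻ unitℤ v∈R
      ...   | a , a∈R , refl = unitℤ-≢ (All.lookup q∉R a∈R)
      basis′ : IsLatticeBasis P (χℤ P I ∷ rest)
      basis′ = IsLatticeBasis-exchange (IsLatticeBasis-resp-↭ reorder basis)
                                       (unitℤ-refl q) (χℤ-∈ (point-∈ I∈)) vanish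

    basis-extension : ∀ T (T⊆Γ : T ⊆ᴸ Γ) → Unique T → AllPairs (λ I J → ∣ J ∣ ℕ.≤ ∣ I ∣) T →
                      BasisExtension T T⊆Γ
    basis-extension []      T⊆Γ _              _                      = basis-extension-[] T⊆Γ
    basis-extension (I ∷ T) T⊆Γ (I∉T ∷ unique) (I-largest ∷ descending) =
      basis-extension-∷ T⊆Γ I∉T I-largest (basis-extension T (T⊆Γ ∘ there) unique descending)

  unimodular : ∀ Γ → IsNearChain P Γ → IsUnimodular P Γ
  unimodular Γ near-chain@(_ , unique-Γ , _) =
    map unitℤ free-points ,
    IsLatticeBasis-resp-↭ (PermP.++⁺ʳ (map unitℤ free-points) (PermP.map⁺ (χℤ P) (sort-↭ Γ))) basis
    where
    open Sort bySize using (sort; sort-↭; sort-↗)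
    open BasisExtension (basis-extension near-chain (sort Γ) (PermP.∈-resp-↭ (sort-↭ Γ))
                           (PermSetoidP.Unique-resp-↭ (≡.setoid (Subset n)) (↭⇒↭ₛ (↭-sym (sort-↭ Γ))) unique-Γ)
                           (Sorted⇒AllPairs (DecTotalOrder.totalOrder bySize) (sort-↗ Γ)))

corollary8 : (P : FinPoset) → IsUnimodularTriangulationOfC P
corollary8 P = covering P , σ⊆C P , σ-face P , intersection-faces , unimodular P
  where
  intersection-faces : ∀ Γ Δ → IsNearChain P Γ → IsNearChain P Δ →
    IsFaceOf P (λ x → σ P Γ x × σ P Δ x) (σ P Γ) × IsFaceOf P (λ x → σ P Γ x × σ P Δ x) (σ P Δ)
  intersection-faces Γ Δ ncΓ ncΔ with intersection-face P Δ Γ ncΔ ncΓ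
  ... | u , supports , face =
    intersection-face P Γ Δ ncΓ ncΔ , u , supports , λ x → proj₁ (face x) ∘ swap , swap ∘ proj₂ (face x)
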